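{- For all natural numbers $n$ and $k$, the number of orbits of size $k$ of the topdrop map in $S_n$ equals $$\sum_{\{\mathcal{N}\in A_n\,:\,|\mathcal{N}|=k\}}\frac{\bigl(n-d(\mathcal{N})\bigr)!}{P(\mathcal{N})},$$ where $d(\mathcal{N})$ is the number of distinct values appearing in $\mathcal{N}$ and $|\mathcal{N}|$ is the size of $\mathcal{N}$.
   Context: Permutations are in one-line notation $\pi=\pi_1\cdots\pi_n$. The topdrop map $T:S_n\to S_n$ is $T(\pi_1\cdots\pi_n)=\pi_{\pi_1+1}\cdots\pi_n\,\pi_{\pi_1}\pi_{\pi_1-1}\cdots\pi_1$ (first $\pi_1$ entries removed, reversed, appended at the end); it is a bijection. The orbit of $\pi$ is $(\pi,T(\pi),\dots,T^{s-1}(\pi))$ with $s\ge1$ minimal such that $T^s(\pi)=\pi$; $s$ is its size. The topdrop-necklace of $\pi$ is the cyclic sequence $[\pi_1,T(\pi)_1,\dots,T^{s-1}(\pi)_1]$ up to cyclic rotation; its size is $s$. $A_n$ is the set of topdrop-valid necklaces in $S_n$, i.e. those arising as the topdrop-necklace of some $\pi\in S_n$. For a necklace $\mathcal{N}=[x_1,\dots,x_s]$, let $t$ be the least $t\ge1$ with $x_{i+t}=x_i$ for all $i$ (indices mod $s$); the fundamental period is $P(\mathcal{N})=s/t$. -}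

module Defs where

open import Data.Nat using (ℕ; zero; suc; _∸_; _/_; _≟_; _!)

open import Data.Bool using (Bool; true; false)
open import Data.List using (List; []; _∷_; _++_; take; drop; reverse; length; map;
  filter; deduplicate; upTo; iterate; concatMap; foldr)
open import Data.List.Properties using (≡-dec)
open import Data.List.Relation.Unary.Unique.Propositional using (Unique)
open import Data.List.Relation.Unary.Unique.DecPropositional using (unique?)
open import Data.List.Relation.Unary.Any using (Any; any?)
open import Data.List.Membership.Propositional using (_∈_)
open import Data.List.Membership.DecPropositional using (_∈?_)
open import Data.Integer using (+_)
open import Data.Rational using (ℚ; 0ℚ) renaming (_/_ to _/ℚ_; _+_ to _+ℚ_)
open import Relation.Nullary using (Dec; yes; no; does)
open import Relation.Binary.PropositionalEquality using (_≡_)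
open import Relation.Binary.Core using (Rel)
open import Relation.Binary.Definitions using (Decidable)

-- Permutations in one-line notation: lists of natural numbers.
Word : Set
Word = List ℕ

_≟w_ : Decidable {A = Word} _≡_
_≟w_ = ≡-dec _≟_

words : ℕ → ℕ → List Word
words n zero    = [] ∷ []
words n (suc m) = concatMap (λ i → map (suc i ∷_) (words n m)) (upTo n)

Sn : ℕ → List Word
Sn n = filter (unique? _≟_) (words n n)

topdrop : Word → Word
topdrop []         = []
topdrop (p ∷ rest) = drop p (p ∷ rest) ++ reverse (take p (p ∷ rest))

topdrop^ : ℕ → Word → Word
topdrop^ zero    π = π
topdrop^ (suc k) π = topdrop^ k (topdrop π)

-- First i in [start, start + fuel) satisfying P; 0 if none.
search : {P : ℕ → Set} → ((i : ℕ) → Dec (P i)) → ℕ → ℕ → ℕ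
search P? start zero = 0
search P? start (suc fuel) with P? start
... | yes _ = start
... | no  _ = search P? (suc start) fuel

-- Orbit size: least s ≥ 1 with T^s π = π.  Since T is a bijection of the
-- finite set S_n (of size n!), such s exists and s ≤ n!, so searching
-- s ∈ [1, n!] finds it for every π ∈ S_n (n = length π).
orbitSize : Word → ℕ
orbitSize π = search (λ s → topdrop^ s π ≟w π) 1 (length π !)

orbit : Word → List Word
orbit π = iterate topdrop π (orbitSize π)

-- first entry (0 on the empty word, irrelevant)
head0 : Word → ℕ
head0 []      = 0
head0 (x ∷ _) = x

-- The topdrop-necklace of π, represented by the sequence
-- [π_1, T(π)_1, …, T^{s-1}(π)_1]; necklaces are such sequences up to rotation.
necklaceSeq : Word → List ℕ
necklaceSeq π = map head0 (orbit π)

SameOrbit : Rel Word _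
SameOrbit π σ = σ ∈ orbit π

sameOrbit? : Decidable SameOrbit
sameOrbit? π σ = _∈?_ _≟w_ σ (orbit π)

rotate : ℕ → List ℕ → List ℕ
rotate j xs = drop j xs ++ take j xs

RotEq : Rel (List ℕ) _
RotEq xs ys = Any (λ j → rotate j xs ≡ ys) (upTo (length xs))

rotEq? : Decidable RotEq
rotEq? xs ys = any? (λ j → rotate j xs ≟w ys) (upTo (length xs))

numOrbits : ℕ → ℕ → ℕ
numOrbits n k =
  length (deduplicate sameOrbit? (filter (λ π → orbitSize π ≟ k) (Sn n)))

-- The topdrop-valid necklaces in S_n of size k (one representative sequence
-- per necklace, i.e. per rotation class).
validNecklaces : ℕ → ℕ → List (List ℕ)
validNecklaces n k =
  deduplicate rotEq? (filter (λ x → length x ≟ k) (map necklaceSeq (Sn n)))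

-- least t ≥ 1 with x_{i+t} = x_i for all i (indices mod s), i.e. rotate t xs = xs;
-- t = s always works, so searching t ∈ [1, s] suffices.
leastShift : List ℕ → ℕ
leastShift xs = search (λ t → rotate t xs ≟w xs) 1 (length xs)

period : List ℕ → ℕ
period xs with leastShift xs
... | zero    = 0
... | suc t   = length xs / suc t

distinctVals : List ℕ → ℕ
distinctVals xs = length (deduplicate _≟_ xs)

-- a / p as a rational (p ≥ 1 for every necklace; the p = 0 case never occurs)
frac : ℕ → ℕ → ℚ
frac a zero    = 0ℚ
frac a (suc p) = (+ a) /ℚ suc p

sumℚ : List ℚ → ℚ
sumℚ = foldr _+ℚ_ 0ℚ

term : ℕ → List ℕ → ℚ
term n xs = frac ((n ∸ distinctVals xs) !) (period xs)

-- Every permutation in an orbit of size k has a necklace sequence of length k, and the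
-- sequence of T π is the left rotation of that of π. So k times the number of orbits of
-- size k counts the permutations whose necklace sequence is a rotation of some valid N
-- of size k. The distinct rotations of N are the sequences of σ, T σ, …, T^(t-1) σ with
-- t = k / P(N), and each sequence x is realised by exactly (n - d)! permutations: topdrop
-- only reads the first entry, so π has the sequence x of σ iff π agrees with σ at the
-- positions of the d values occurring in x, while its other n - d entries are arbitrary.
-- Dividing t · (n - d)! by k gives (n - d)! / P(N).
module Submission where

open import Defs
open import Data.Nat using (ℕ)
open import Data.List using (map)
open import Data.Integer using (+_)
open import Data.Rational using (ℚ) renaming (_/_ to _/ℚ_)
open import Relation.Binary.PropositionalEquality using (_≡_)

open import Data.Empty using (⊥-elim)
open import Data.Integer using () renaming (_*_ to _ℤ*_; _+_ to _ℤ+_)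
import Data.Integer.Properties as ℤ
open import Data.List
  using (List; []; _∷_; [_]; _++_; _∷ʳ_; take; drop; reverse; length; filter; concatMap; deduplicate;
         upTo; catMaybes; replicate; applyUpTo; iterate)
open import Data.List.Properties
  using (filter-none; ∷-injective; length-map; length-upTo; length-replicate; length-applyUpTo; length-iterate;
         length-drop; length-++; length-filter; take++drop≡id; take-map; drop-map; reverse-map; map-++;
         ∷ʳ-injective; reverse-injective; unfold-reverse; ++-assoc; ++-identityʳ; drop-all; take-all;
         map-applyUpTo; applyUpTo-∷ʳ; map-cong-local; ++-conicalʳ)
import Data.List.Membership.DecPropositional as DecMembership
open import Data.List.Membership.Propositional using (_∈_; _∉_; find; lose)
open import Data.List.Membership.Propositional.Properties
  using (∈-filter⁺; ∈-filter⁻; ∈-deduplicate⁺; ∈-deduplicate⁻; ∈-++⁺ˡ; ∈-++⁺ʳ; ∈-++⁻; ∈-map⁺; ∈-map⁻;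
         ∈-concatMap⁺; ∈-concatMap⁻; ∈-upTo⁺; ∈-upTo⁻; ∈-applyUpTo⁺; ∈-applyUpTo⁻)
open import Data.List.Membership.Propositional.Properties.WithK using (unique∧set⇒bag)
open import Data.List.Relation.Binary.BagAndSetEquality using (∼bag⇒↭)
open import Data.List.Relation.Binary.Disjoint.Propositional using (Disjoint)
open import Data.List.Relation.Binary.Permutation.Propositional
  using (_↭_; ↭-refl; ↭-sym; ↭-trans; ↭⇒↭ₛ; module PermutationReasoning)
open import Data.List.Relation.Binary.Permutation.Propositional.Properties
  using (↭-length; All-resp-↭; ∈-resp-↭; shift; ++⁺ˡ; ↭-reverse; ++-comm)
import Data.List.Relation.Binary.Permutation.Setoid.Properties as SetoidPermutation
open import Data.List.Relation.Binary.Pointwise as Pointwise using (Pointwise; []; _∷_)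
open import Data.List.Relation.Binary.Subset.Propositional using (_⊆_)
open import Data.List.Relation.Unary.All as All using (All; []; _∷_)
import Data.List.Relation.Unary.All.Properties as All
open import Data.List.Relation.Unary.AllPairs using (AllPairs; []; _∷_) renaming (map to mapAllPairs)
import Data.List.Relation.Unary.AllPairs.Properties as AllPairs
open import Data.List.Relation.Unary.Any using (here; there)
open import Data.List.Relation.Unary.Unique.DecPropositional using (unique?)
open import Data.List.Relation.Unary.Unique.DecPropositional.Properties using (deduplicate-!)
open import Data.List.Relation.Unary.Unique.Propositional using (Unique)
import Data.List.Relation.Unary.Unique.Propositional.Properties as Unique
open import Data.Maybe using (Maybe; just; nothing)
open import Data.Nat
  using (NonZero; >-nonZero; zero; suc; pred; _+_; _*_; _∸_; _/_; _%_; _≤_; _<_; z≤n; s≤s; _≟_; _!)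
open import Data.Nat.DivMod using (m≡m%n+[m/n]*n; m%n<n)
open import Data.Nat.Properties
open import Algebra.Properties.CommutativeSemigroup +-commutativeSemigroup
  using () renaming (interchange to +-interchange)
open import Algebra.Properties.CommutativeSemigroup *-commutativeSemigroup
  using () renaming (x∙yz≈yx∙z to x*[y*z]≡y*x*z)
open import Data.Product using (∃; _×_; _,_; proj₁; proj₂)
open import Data.Rational using (toℚᵘ) renaming (_+_ to _+ℚ_)
import Data.Rational.Properties as ℚ
open import Data.Rational.Unnormalised using (mkℚᵘ; *≡*) renaming (_+_ to _+ᵘ_; _≃_ to _≃ᵘ_)
import Data.Rational.Unnormalised.Properties as ℚᵘ
open import Data.Sum using (_⊎_; inj₁; inj₂)
open import Data.Unit using (⊤; tt)
open import Function using (_∘_; _⇔_; mk⇔; Equivalence; case_of_)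
open import Relation.Binary using (DecidableEquality; tri<; tri≈; tri>)
import Relation.Binary.Definitions as Binary
open import Relation.Binary.PropositionalEquality
  using (_≢_; refl; setoid; sym; trans; cong; cong₂; subst; module ≡-Reasoning)
open import Relation.Nullary using (Dec; yes; no; ¬_; ¬?; _×-dec_)
open import Relation.Unary using (Decidable)


private variable
  A B : Set

_∈ℕ?_ : (v : ℕ) (xs : List ℕ) → Dec (v ∈ xs)
_∈ℕ?_ = DecMembership._∈?_ _≟_

Unique-resp-↭ : {xs ys : List A} → xs ↭ ys → Unique xs → Unique ys
Unique-resp-↭ {A} = SetoidPermutation.Unique-resp-↭ (setoid A) ∘ ↭⇒↭ₛ

-- Counting in lists

∑ : List A → (A → ℕ) → ℕ
∑ []       f = 0
∑ (x ∷ xs) f = f x + ∑ xs f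

syntax ∑ xs (λ x → e) = ∑[ x ← xs ] e

𝟙 : {P : Set} → Dec P → ℕ
𝟙 (yes _) = 1
𝟙 (no _)  = 0

module _ {P : Set} where

  𝟙-yes : (p : Dec P) → P → 𝟙 p ≡ 1
  𝟙-yes (yes _) _  = refl
  𝟙-yes (no ¬p) p = ⊥-elim (¬p p)

  𝟙-no : (p : Dec P) → ¬ P → 𝟙 p ≡ 0
  𝟙-no (yes p) ¬p = ⊥-elim (¬p p)
  𝟙-no (no _)  _  = refl

  𝟙-+-𝟙-¬ : (p : Dec P) → 𝟙 p + 𝟙 (¬? p) ≡ 1
  𝟙-+-𝟙-¬ (yes _) = refl
  𝟙-+-𝟙-¬ (no _)  = refl

module _ {P Q : Set} where

  𝟙-cong : (p : Dec P) (q : Dec Q) → P ⇔ Q → 𝟙 p ≡ 𝟙 q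
  𝟙-cong (yes _) (yes _) _   = refl
  𝟙-cong (yes p) (no ¬q) P⇔Q = ⊥-elim (¬q (Equivalence.to P⇔Q p))
  𝟙-cong (no ¬p) (yes q) P⇔Q = ⊥-elim (¬p (Equivalence.from P⇔Q q))
  𝟙-cong (no _)  (no _)  _   = refl

  𝟙-× : (p : Dec P) (q : Dec Q) → 𝟙 (p ×-dec q) ≡ 𝟙 p * 𝟙 q
  𝟙-× (yes _) (yes _) = refl
  𝟙-× (yes _) (no _)  = refl
  𝟙-× (no _)  (yes _) = refl
  𝟙-× (no _)  (no _)  = refl

module _ {f g : A → ℕ} where

  ∑-cong : (xs : List A) → (∀ {x} → x ∈ xs → f x ≡ g x) → ∑ xs f ≡ ∑ xs g
  ∑-cong []       _ = refl
  ∑-cong (x ∷ xs) f≗g = cong₂ _+_ (f≗g (here refl)) (∑-cong xs (f≗g ∘ there))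

  ∑-+ : (xs : List A) → ∑[ x ← xs ] (f x + g x) ≡ ∑ xs f + ∑ xs g
  ∑-+ []       = refl
  ∑-+ (x ∷ xs) = trans (cong (_+_ (f x + g x)) (∑-+ xs)) (+-interchange (f x) (g x) (∑ xs f) (∑ xs g))

∑-*ˡ : (c : ℕ) (f : A → ℕ) (xs : List A) → ∑[ x ← xs ] (c * f x) ≡ c * ∑ xs f
∑-*ˡ c f []       = sym (*-zeroʳ c)
∑-*ˡ c f (x ∷ xs) = trans (cong (_+_ (c * f x)) (∑-*ˡ c f xs)) (sym (*-distribˡ-+ c (f x) _))

∑-*ʳ : (c : ℕ) (f : A → ℕ) (xs : List A) → ∑[ x ← xs ] (f x * c) ≡ ∑ xs f * c
∑-*ʳ c f xs = trans (∑-cong xs (λ {x} _ → *-comm (f x) c)) (trans (∑-*ˡ c f xs) (*-comm c (∑ xs f)))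

∑-const : (c : ℕ) (xs : List A) → ∑[ _ ← xs ] c ≡ length xs * c
∑-const c []       = refl
∑-const c (x ∷ xs) = cong (_+_ c) (∑-const c xs)

∑-map : (h : A → B) (g : B → ℕ) (xs : List A) → ∑ (map h xs) g ≡ ∑ xs (g ∘ h)
∑-map h g []       = refl
∑-map h g (x ∷ xs) = cong (_+_ (g (h x))) (∑-map h g xs)

∑-++ : (f : A → ℕ) (xs ys : List A) → ∑ (xs ++ ys) f ≡ ∑ xs f + ∑ ys f
∑-++ f []       ys = refl
∑-++ f (x ∷ xs) ys = trans (cong (_+_ (f x)) (∑-++ f xs ys)) (sym (+-assoc (f x) _ _))

∑-concatMap : (h : A → List B) (g : B → ℕ) (xs : List A) →
              ∑ (concatMap h xs) g ≡ ∑[ x ← xs ] ∑ (h x) g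
∑-concatMap h g []       = refl
∑-concatMap h g (x ∷ xs) = trans (∑-++ g (h x) _) (cong (_+_ (∑ (h x) g)) (∑-concatMap h g xs))

∑-comm : (f : A → B → ℕ) (xs : List A) (ys : List B) →
         ∑[ x ← xs ] ∑ ys (f x) ≡ ∑[ y ← ys ] ∑[ x ← xs ] f x y
∑-comm f []       ys = sym (trans (∑-const 0 ys) (*-zeroʳ (length ys)))
∑-comm f (x ∷ xs) ys = trans (cong (_+_ (∑ ys (f x))) (∑-comm f xs ys)) (sym (∑-+ ys))

module _ {P : A → Set} (P? : Decidable P) where

  ∑-filter : (g : A → ℕ) (xs : List A) → ∑ (filter P? xs) g ≡ ∑[ x ← xs ] (𝟙 (P? x) * g x)
  ∑-filter g []       = refl
  ∑-filter g (x ∷ xs) with P? x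
  ... | yes _ = cong₂ _+_ (sym (+-identityʳ (g x))) (∑-filter g xs)
  ... | no _  = ∑-filter g xs

  length-filter≡∑𝟙 : (xs : List A) → length (filter P? xs) ≡ ∑[ x ← xs ] 𝟙 (P? x)
  length-filter≡∑𝟙 []       = refl
  length-filter≡∑𝟙 (x ∷ xs) with P? x
  ... | yes _ = cong suc (length-filter≡∑𝟙 xs)
  ... | no _  = length-filter≡∑𝟙 xs

length-≡-of-same-members : {xs ys : List A} → Unique xs → Unique ys →
                           (∀ {v} → v ∈ xs ⇔ v ∈ ys) → length xs ≡ length ys
length-≡-of-same-members uxs uys xs≈ys = ↭-length (∼bag⇒↭ (unique∧set⇒bag uxs uys xs≈ys))

module _ (_≟ᴬ_ : DecidableEquality A) where
  open DecMembership _≟ᴬ_ using (_∈?_)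

  length-≤-of-⊆ : {xs ys : List A} → Unique xs → Unique ys → xs ⊆ ys → length xs ≤ length ys
  length-≤-of-⊆ {xs} {ys} uxs uys xs⊆ys = begin
    length xs                       ≡⟨ length-≡-of-same-members uxs (Unique.filter⁺ (_∈? xs) uys)
                                         (mk⇔ (λ v∈xs → ∈-filter⁺ (_∈? xs) (xs⊆ys v∈xs) v∈xs)
                                              (proj₂ ∘ ∈-filter⁻ (_∈? xs) {xs = ys})) ⟩
    length (filter (_∈? xs) ys)     ≤⟨ length-filter (_∈? xs) ys ⟩
    length ys                       ∎
    where open ≤-Reasoning

-- SameOrbit and RotEq are equivalences only on permutations, resp. nonempty lists.
record IsEquivalenceOn (Ok : A → Set) (R : A → A → Set) : Set where
  field
    reflexive  : ∀ {x} → Ok x → R x x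
    symmetric  : ∀ {x y} → Ok x → Ok y → R x y → R y x
    transitive : ∀ {x y z} → Ok x → Ok y → Ok z → R x y → R y z → R x z

module Classes {R : A → A → Set} (R? : Binary.Decidable R)
               {Ok : A → Set} (isEquivalence : IsEquivalenceOn Ok R) where
  open IsEquivalenceOn isEquivalence

  deduplicate-pairwise : (xs : List A) → AllPairs (λ a b → ¬ R a b) (deduplicate R? xs)
  deduplicate-pairwise []       = []
  deduplicate-pairwise (x ∷ xs) =
    All.all-filter (¬? ∘ R? x) (deduplicate R? xs) ∷ AllPairs.filter⁺ (¬? ∘ R? x) (deduplicate-pairwise xs)

  deduplicate-represents : {xs : List A} → All Ok xs → ∀ {x} → x ∈ xs →
                           ∃ λ r → r ∈ deduplicate R? xs × R r x
  deduplicate-represents (ok ∷ _) (here refl) = _ , here refl , reflexive ok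
  deduplicate-represents {y ∷ ys} (oky ∷ oks) (there x∈ys)
    with r , r∈ , Rrx ← deduplicate-represents oks x∈ys
    with R? y r
  ... | yes Ryr = y , here refl , transitive oky (All.lookup oks (∈-deduplicate⁻ R? ys r∈)) (All.lookup oks x∈ys) Ryr Rrx
  ... | no ¬Ryr = r , there (∈-filter⁺ (¬? ∘ R? y) r∈ ¬Ryr) , Rrx

  private
    at-most-one : ∀ {x rs} → Ok x → AllPairs (λ a b → ¬ R a b) rs → All (λ r → Ok r × R r x) rs →
                  ∀ {r} → r ∈ rs → length rs ≡ 1
    at-most-one okx (_ ∷ [])                    _ _ = refl
    at-most-one okx ((¬Rab ∷ _) ∷ _) ((oka , Rax) ∷ (okb , Rbx) ∷ _) _ =
      ⊥-elim (¬Rab (transitive oka okx okb Rax (symmetric okb okx Rbx)))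

  unique-representative : {xs : List A} → All Ok xs → ∀ {x} → x ∈ xs →
                          length (filter (λ r → R? r x) (deduplicate R? xs)) ≡ 1
  unique-representative {xs} oks {x} x∈xs with r , r∈ , Rrx ← deduplicate-represents oks x∈xs =
    at-most-one (All.lookup oks x∈xs)
      (AllPairs.filter⁺ R?·x (deduplicate-pairwise xs))
      (All.zip (All.filter⁺ R?·x (All.tabulate (All.lookup oks ∘ ∈-deduplicate⁻ R? xs)) ,
                All.all-filter R?·x (deduplicate R? xs)))
      (∈-filter⁺ R?·x r∈ Rrx)
    where
    R?·x : Decidable (λ r → R r x)
    R?·x r = R? r x

  length≡∑-class-sizes : {xs : List A} → All Ok xs →
                         length xs ≡ ∑[ r ← deduplicate R? xs ] length (filter (R? r) xs)
  length≡∑-class-sizes {xs} oks = begin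
    length xs                              ≡⟨ trans (∑-const 1 xs) (*-identityʳ _) ⟨
    ∑[ x ← xs ] 1                          ≡⟨ ∑-cong xs one-representative ⟩
    ∑[ x ← xs ] ∑[ r ← D ] 𝟙 (R? r x)      ≡⟨ ∑-comm (λ x r → 𝟙 (R? r x)) xs D ⟩
    ∑[ r ← D ] ∑[ x ← xs ] 𝟙 (R? r x)      ≡⟨ ∑-cong D (λ {r} _ → sym (length-filter≡∑𝟙 (R? r) xs)) ⟩
    ∑[ r ← D ] length (filter (R? r) xs)   ∎
    where
    open ≡-Reasoning
    D = deduplicate R? xs
    one-representative : ∀ {x} → x ∈ xs → 1 ≡ ∑[ r ← D ] 𝟙 (R? r x)
    one-representative {x} x∈xs =
      trans (sym (unique-representative oks x∈xs)) (length-filter≡∑𝟙 (λ r → R? r x) D)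

-- Least solutions and bounded search

record IsLeast (P : ℕ → Set) (lo r : ℕ) : Set where
  field
    lower : lo ≤ r
    holds : P r
    least : ∀ {j} → lo ≤ j → j < r → ¬ P j

module _ {P : ℕ → Set} where

  IsLeast-unique : ∀ {lo r r′} → IsLeast P lo r → IsLeast P lo r′ → r ≡ r′
  IsLeast-unique l l′ =
    ≤-antisym (≮⇒≥ λ r′<r → IsLeast.least l  (IsLeast.lower l′) r′<r (IsLeast.holds l′))
              (≮⇒≥ λ r<r′ → IsLeast.least l′ (IsLeast.lower l)  r<r′ (IsLeast.holds l))

  private
    IsLeast-from-suc : ∀ {lo r} → ¬ P lo → IsLeast P (suc lo) r → IsLeast P lo r
    IsLeast-from-suc {lo} {r} ¬Plo l = record
      { lower = ≤-trans (n≤1+n lo) (IsLeast.lower l)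
      ; holds = IsLeast.holds l
      ; least = least ∘ m≤n⇒m<n∨m≡n }
      where
      least : ∀ {j} → lo < j ⊎ lo ≡ j → j < r → ¬ P j
      least (inj₁ lo<j) = IsLeast.least l lo<j
      least (inj₂ refl) = λ _ → ¬Plo

  search-least : (P? : Decidable P) (lo fuel : ℕ) {s : ℕ} → lo ≤ s → s < lo + fuel → P s →
                 IsLeast P lo (search P? lo fuel) × search P? lo fuel ≤ s
  search-least P? lo zero       {s} lo≤s s<lo+0 _ = ⊥-elim (<⇒≱ (subst (s <_) (+-identityʳ lo) s<lo+0) lo≤s)
  search-least P? lo (suc fuel) {s} lo≤s s<     Ps with P? lo
  ... | yes Plo = record { lower = ≤-refl ; holds = Plo ; least = λ lo≤j j<lo _ → <⇒≱ j<lo lo≤j } , lo≤s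
  ... | no ¬Plo with m≤n⇒m<n∨m≡n lo≤s
  ...   | inj₂ refl = ⊥-elim (¬Plo Ps)
  ...   | inj₁ lo<s with l , r≤s ← search-least P? (suc lo) fuel lo<s (subst (s <_) (+-suc lo fuel) s<) Ps =
    IsLeast-from-suc ¬Plo l , r≤s

-- Words and permutations

InRange : ℕ → ℕ → Set
InRange n v = 1 ≤ v × v ≤ n

record IsPermutation (n : ℕ) (w : Word) : Set where
  field
    length≡ : length w ≡ n
    inRange : All (InRange n) w
    unique  : Unique w

words-sound : ∀ n m {w} → w ∈ words n m → length w ≡ m × All (InRange n) w
words-sound n zero    (here refl) = refl , []
words-sound n (suc m) w∈
  with i , i∈ , w∈′ ← find (∈-concatMap⁻ (λ i → map (suc i ∷_) (words n m)) {xs = upTo n} w∈)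
  with w′ , w′∈ , refl ← ∈-map⁻ (suc i ∷_) w∈′
  with length≡ , inRange ← words-sound n m w′∈ = cong suc length≡ , (s≤s z≤n , ∈-upTo⁻ i∈) ∷ inRange

words-complete : ∀ n {w} → All (InRange n) w → w ∈ words n (length w)
words-complete n []                           = here refl
words-complete n {suc i ∷ w} ((_ , i<n) ∷ inRange) =
  ∈-concatMap⁺ (λ j → map (suc j ∷_) (words n (length w))) {xs = upTo n}
    (lose (∈-upTo⁺ i<n) (∈-map⁺ (suc i ∷_) (words-complete n inRange)))

words-unique : ∀ n m → Unique (words n m)
words-unique n zero    = [] ∷ []
words-unique n (suc m) = Unique.concat⁺
  (All.map⁺ (All.universal (λ i → Unique.map⁺ (proj₂ ∘ ∷-injective) (words-unique n m)) (upTo n)))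
  (AllPairs.map⁺ (mapAllPairs disjoint (Unique.upTo⁺ n)))
  where
  disjoint : ∀ {i j} → i ≢ j → Disjoint (map (suc i ∷_) (words n m)) (map (suc j ∷_) (words n m))
  disjoint i≢j (w∈i , w∈j) with _ , _ , refl ← ∈-map⁻ _ w∈i | _ , _ , eq ← ∈-map⁻ _ w∈j =
    i≢j (suc-injective (proj₁ (∷-injective eq)))

∈-Sn⁻ : ∀ {n w} → w ∈ Sn n → IsPermutation n w
∈-Sn⁻ {n} w∈
  with w∈words , unique ← ∈-filter⁻ (unique? _≟_) {xs = words n n} w∈
  with length≡ , inRange ← words-sound n n w∈words = record { length≡ = length≡ ; inRange = inRange ; unique = unique }

∈-Sn⁺ : ∀ {n w} → IsPermutation n w → w ∈ Sn n
∈-Sn⁺ {n} {w} p = ∈-filter⁺ (unique? _≟_) (subst (λ m → w ∈ words n m) length≡ (words-complete n inRange)) unique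
  where open IsPermutation p

Sn-unique : ∀ n → Unique (Sn n)
Sn-unique n = Unique.filter⁺ (unique? _≟_) (words-unique n n)

-- Counting permutations that extend a partial word

Pattern : Set
Pattern = List (Maybe ℕ)

Fits : Maybe ℕ → ℕ → Set
Fits nothing  _ = ⊤
Fits (just u) v = u ≡ v

fits? : ∀ c v → Dec (Fits c v)
fits? nothing  _ = yes tt
fits? (just u) v = u ≟ v

Extends : Pattern → Word → Set
Extends = Pointwise Fits

extends? : ∀ cs w → Dec (Extends cs w)
extends? = Pointwise.decidable fits?

holes : Pattern → ℕ
holes []            = 0
holes (nothing ∷ cs) = suc (holes cs)
holes (just _ ∷ cs)  = holes cs

fallingFactorial : ℕ → ℕ → ℕ
fallingFactorial a zero    = 1
fallingFactorial a (suc r) = a * fallingFactorial (pred a) r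

fallingFactorial-n-n : ∀ n → fallingFactorial n n ≡ n !
fallingFactorial-n-n zero    = refl
fallingFactorial-n-n (suc n) = cong (suc n *_) (fallingFactorial-n-n n)

FreshExtension : List ℕ → Pattern → Word → Set
FreshExtension F cs w = Unique w × All (_∉ F) w × Extends cs w

freshExtension? : ∀ F cs w → Dec (FreshExtension F cs w)
freshExtension? F cs w = unique? _≟_ w ×-dec All.all? (λ v → ¬? (v ∈ℕ? F)) w ×-dec extends? cs w

freshExtension-∷ : ∀ F c cs v w →
  FreshExtension F (c ∷ cs) (v ∷ w) ⇔ ((v ∉ F × Fits c v) × FreshExtension (v ∷ F) cs w)
freshExtension-∷ F c cs v w = mk⇔
  (λ { ((v∉w ∷ uw) , (v∉F ∷ w∉F) , (fits ∷ ext)) →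
         (v∉F , fits) , uw , All.zipWith ∉-∷ (v∉w , w∉F) , ext })
  (λ { ((v∉F , fits) , uw , w∉vF , ext) →
         (All.map (λ u∉vF → u∉vF ∘ here ∘ sym) w∉vF ∷ uw) ,
         (v∉F ∷ All.map (_∘ there) w∉vF) ,
         (fits ∷ ext) })
  where
  ∉-∷ : ∀ {u} → v ≢ u × u ∉ F → u ∉ v ∷ F
  ∉-∷ (v≢u , _)   (here u≡v)  = v≢u (sym u≡v)
  ∉-∷ (_   , u∉F) (there u∈F) = u∉F u∈F

-- F collects the letters used by an already placed prefix, so that the count can proceed one
-- position at a time.
countFresh : ℕ → List ℕ → Pattern → ℕ
countFresh n F cs = ∑[ w ← words n (length cs) ] 𝟙 (freshExtension? F cs w)

countFresh-∷ : ∀ n F c cs → countFresh n F (c ∷ cs) ≡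
  ∑[ i ← upTo n ] (𝟙 (¬? (suc i ∈ℕ? F) ×-dec fits? c (suc i)) * countFresh n (suc i ∷ F) cs)
countFresh-∷ n F c cs = begin
  ∑ (concatMap (λ i → map (suc i ∷_) (words n (length cs))) (upTo n)) ext
    ≡⟨ ∑-concatMap _ ext (upTo n) ⟩
  ∑[ i ← upTo n ] ∑ (map (suc i ∷_) (words n (length cs))) ext
    ≡⟨ ∑-cong (upTo n) (λ {i} _ → trans (∑-map (suc i ∷_) ext (words n (length cs))) (first-letter i)) ⟩
  ∑[ i ← upTo n ] (𝟙 (¬? (suc i ∈ℕ? F) ×-dec fits? c (suc i)) * countFresh n (suc i ∷ F) cs) ∎
  where
  open ≡-Reasoning
  ext : Word → ℕ
  ext = 𝟙 ∘ freshExtension? F (c ∷ cs)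
  first-letter : ∀ i → ∑[ w ← words n (length cs) ] ext (suc i ∷ w) ≡
                       𝟙 (¬? (suc i ∈ℕ? F) ×-dec fits? c (suc i)) * countFresh n (suc i ∷ F) cs
  first-letter i = trans (∑-cong (words n (length cs)) (λ {w} _ →
                           trans (𝟙-cong _ (fresh? ×-dec freshExtension? (suc i ∷ F) cs w)
                                            (freshExtension-∷ F c cs (suc i) w))
                                 (𝟙-× fresh? (freshExtension? (suc i ∷ F) cs w))))
                         (∑-*ˡ (𝟙 fresh?) (𝟙 ∘ freshExtension? (suc i ∷ F) cs) (words n (length cs)))
    where fresh? = ¬? (suc i ∈ℕ? F) ×-dec fits? c (suc i)

countFresh-blocked : ∀ n F cs {u} → u ∈ F → u ∈ catMaybes cs → countFresh n F cs ≡ 0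
countFresh-blocked n F cs u∈F u∈cs =
  trans (∑-cong (words n (length cs)) (λ {w} _ → 𝟙-no (freshExtension? F cs w)
          (λ { (_ , w∉F , ext) → All.lookup w∉F (extends-∈ ext u∈cs) u∈F })))
        (trans (∑-const 0 (words n (length cs))) (*-zeroʳ (length (words n (length cs)))))
  where
  extends-∈ : ∀ {cs w u} → Extends cs w → u ∈ catMaybes cs → u ∈ w
  extends-∈ {nothing ∷ _} (_    ∷ ext) u∈         = there (extends-∈ ext u∈)
  extends-∈ {just _ ∷ _}  (refl ∷ ext) (here refl) = here refl
  extends-∈ {just _ ∷ _}  (_    ∷ ext) (there u∈) = there (extends-∈ ext u∈)

module _ {n : ℕ} {G : List ℕ} (uniqueG : Unique G) (G-inRange : All (InRange n) G) where

  ∑-𝟙-∈ : ∑[ i ← upTo n ] 𝟙 (suc i ∈ℕ? G) ≡ length G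
  ∑-𝟙-∈ = begin
    ∑[ i ← upTo n ] 𝟙 (suc i ∈ℕ? G)   ≡⟨ length-filter≡∑𝟙 (λ i → suc i ∈ℕ? G) (upTo n) ⟨
    length I                          ≡⟨ length-map suc I ⟨
    length (map suc I)                ≡⟨ length-≡-of-same-members unique-sucI uniqueG (mk⇔ in-G in-image) ⟩
    length G                          ∎
    where
    open ≡-Reasoning
    I = filter (λ i → suc i ∈ℕ? G) (upTo n)
    unique-sucI : Unique (map suc I)
    unique-sucI = Unique.map⁺ suc-injective (Unique.filter⁺ (λ i → suc i ∈ℕ? G) (Unique.upTo⁺ n))
    in-G : ∀ {v} → v ∈ map suc I → v ∈ G
    in-G v∈ with i , i∈ , refl ← ∈-map⁻ suc v∈ = proj₂ (∈-filter⁻ (λ i → suc i ∈ℕ? G) {xs = upTo n} i∈)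
    in-image : ∀ {v} → v ∈ G → v ∈ map suc I
    in-image v∈G with s≤s z≤n , i<n ← All.lookup G-inRange v∈G =
      ∈-map⁺ suc (∈-filter⁺ (λ i → suc i ∈ℕ? G) (∈-upTo⁺ i<n) v∈G)

  ∑-𝟙-∉ : ∑[ i ← upTo n ] 𝟙 (¬? (suc i ∈ℕ? G)) ≡ n ∸ length G
  ∑-𝟙-∉ = begin
    ∑[ i ← upTo n ] 𝟙 (¬? (suc i ∈ℕ? G))                        ≡⟨ m+n∸m≡n (length G) out ⟨
    length G + out ∸ length G                                    ≡⟨ cong (λ m → m + out ∸ length G) ∑-𝟙-∈ ⟨
    ∑[ i ← upTo n ] 𝟙 (suc i ∈ℕ? G) + out ∸ length G             ≡⟨ cong (_∸ length G) in+out≡n ⟩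
    n ∸ length G                                                 ∎
    where
    open ≡-Reasoning
    out = ∑[ i ← upTo n ] 𝟙 (¬? (suc i ∈ℕ? G))
    in+out≡n : ∑[ i ← upTo n ] 𝟙 (suc i ∈ℕ? G) + out ≡ n
    in+out≡n = begin
      ∑[ i ← upTo n ] 𝟙 (suc i ∈ℕ? G) + out                      ≡⟨ ∑-+ (upTo n) ⟨
      ∑[ i ← upTo n ] (𝟙 (suc i ∈ℕ? G) + 𝟙 (¬? (suc i ∈ℕ? G)))
        ≡⟨ ∑-cong (upTo n) (λ {i} _ → 𝟙-+-𝟙-¬ (suc i ∈ℕ? G)) ⟩
      ∑[ i ← upTo n ] 1                                          ≡⟨ ∑-const 1 (upTo n) ⟩
      length (upTo n) * 1                                        ≡⟨ *-identityʳ (length (upTo n)) ⟩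
      length (upTo n)                                            ≡⟨ length-upTo n ⟩
      n                                                          ∎

countFresh-just : ∀ n F u cs → u ∉ F → InRange n u → countFresh n F (just u ∷ cs) ≡ countFresh n (u ∷ F) cs
countFresh-just n F u cs u∉F u-inRange = begin
  countFresh n F (just u ∷ cs)
    ≡⟨ countFresh-∷ n F (just u) cs ⟩
  ∑[ i ← upTo n ] (𝟙 (¬? (suc i ∈ℕ? F) ×-dec (u ≟ suc i)) * countFresh n (suc i ∷ F) cs)
    ≡⟨ ∑-cong (upTo n) (λ {i} _ → only-u i) ⟩
  ∑[ i ← upTo n ] (𝟙 (suc i ∈ℕ? [ u ]) * C)
    ≡⟨ ∑-*ʳ C (λ i → 𝟙 (suc i ∈ℕ? [ u ])) (upTo n) ⟩
  ∑[ i ← upTo n ] 𝟙 (suc i ∈ℕ? [ u ]) * C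
    ≡⟨ cong (_* C) (∑-𝟙-∈ ([] ∷ []) (u-inRange ∷ [])) ⟩
  1 * C
    ≡⟨ *-identityˡ C ⟩
  C ∎
  where
  open ≡-Reasoning
  C = countFresh n (u ∷ F) cs
  only-u : ∀ i → 𝟙 (¬? (suc i ∈ℕ? F) ×-dec (u ≟ suc i)) * countFresh n (suc i ∷ F) cs ≡
                 𝟙 (suc i ∈ℕ? [ u ]) * C
  only-u i with u ≟ suc i
  ... | yes refl = cong (_* C) (trans (𝟙-yes (¬? (u ∈ℕ? F) ×-dec yes refl) (u∉F , refl))
                                      (sym (𝟙-yes (u ∈ℕ? [ u ]) (here refl))))
  ... | no u≢i   = trans (cong (_* countFresh n (suc i ∷ F) cs)
                               (𝟙-no (¬? (suc i ∈ℕ? F) ×-dec no u≢i) (u≢i ∘ proj₂)))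
                         (sym (cong (_* C) (𝟙-no (suc i ∈ℕ? [ u ]) λ { (here i≡u) → u≢i (sym i≡u) })))

countFresh≡fallingFactorial : ∀ n F cs → Unique (F ++ catMaybes cs) → All (InRange n) (F ++ catMaybes cs) →
  countFresh n F cs ≡ fallingFactorial (n ∸ length (F ++ catMaybes cs)) (holes cs)
countFresh≡fallingFactorial n F [] _ _ = trans (+-identityʳ _) (𝟙-yes (freshExtension? F [] []) ([] , [] , []))
countFresh≡fallingFactorial n F (just u ∷ cs) uG rG = begin
  countFresh n F (just u ∷ cs)
    ≡⟨ countFresh-just n F u cs u∉F (All.lookup rG (∈-++⁺ʳ F (here refl))) ⟩
  countFresh n (u ∷ F) cs
    ≡⟨ countFresh≡fallingFactorial n (u ∷ F) cs (Unique-resp-↭ u-first uG) (All-resp-↭ u-first rG) ⟩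
  fallingFactorial (n ∸ length (u ∷ F ++ J)) (holes cs)
    ≡⟨ cong (λ m → fallingFactorial (n ∸ m) (holes cs)) (↭-length u-first) ⟨
  fallingFactorial (n ∸ length (F ++ u ∷ J)) (holes cs) ∎
  where
  open ≡-Reasoning
  J = catMaybes cs
  u-first : F ++ u ∷ J ↭ u ∷ F ++ J
  u-first = shift u F J
  u∉F : u ∉ F
  u∉F u∈F with u∉FJ ∷ _ ← Unique-resp-↭ u-first uG = All.lookup u∉FJ (∈-++⁺ˡ u∈F) refl
countFresh≡fallingFactorial n F (nothing ∷ cs) uG rG = begin
  countFresh n F (nothing ∷ cs)
    ≡⟨ countFresh-∷ n F nothing cs ⟩
  ∑[ i ← upTo n ] (𝟙 (¬? (suc i ∈ℕ? F) ×-dec yes tt) * countFresh n (suc i ∷ F) cs)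
    ≡⟨ ∑-cong (upTo n) (fresh-letter ∘ ∈-upTo⁻) ⟩
  ∑[ i ← upTo n ] (𝟙 (¬? (suc i ∈ℕ? G)) * rest)
    ≡⟨ ∑-*ʳ rest (λ i → 𝟙 (¬? (suc i ∈ℕ? G))) (upTo n) ⟩
  ∑[ i ← upTo n ] 𝟙 (¬? (suc i ∈ℕ? G)) * rest
    ≡⟨ cong (_* rest) (∑-𝟙-∉ uG rG) ⟩
  (n ∸ length G) * rest
    ≡⟨ cong (λ m → (n ∸ length G) * fallingFactorial m (holes cs)) (pred[m∸n]≡m∸[1+n] n (length G)) ⟨
  fallingFactorial (n ∸ length G) (suc (holes cs)) ∎
  where
  open ≡-Reasoning
  G = F ++ catMaybes cs
  rest = fallingFactorial (n ∸ suc (length G)) (holes cs)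
  fresh? : ∀ i → Dec (suc i ∉ F × ⊤)
  fresh? i = ¬? (suc i ∈ℕ? F) ×-dec yes tt
  fresh-letter : ∀ {i} → i < n → 𝟙 (fresh? i) * countFresh n (suc i ∷ F) cs ≡ 𝟙 (¬? (suc i ∈ℕ? G)) * rest
  fresh-letter {i} i<n with suc i ∈ℕ? G
  ... | no i∉G = cong₂ _*_ (𝟙-yes (fresh? i) (i∉G ∘ ∈-++⁺ˡ , tt))
                           (countFresh≡fallingFactorial n (suc i ∷ F) cs
                              (All.¬Any⇒All¬ G i∉G ∷ uG) ((s≤s z≤n , i<n) ∷ rG))
  ... | yes i∈G with ∈-++⁻ F i∈G
  ...   | inj₁ i∈F  = cong (_* countFresh n (suc i ∷ F) cs) (𝟙-no (fresh? i) (λ (i∉F , _) → i∉F i∈F))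
  ...   | inj₂ i∈cs = trans (cong (𝟙 (fresh? i) *_) (countFresh-blocked n (suc i ∷ F) cs (here refl) i∈cs))
                            (*-zeroʳ (𝟙 (fresh? i)))

length≡holes+filled : ∀ cs → length cs ≡ holes cs + length (catMaybes cs)
length≡holes+filled []             = refl
length≡holes+filled (nothing ∷ cs) = cong suc (length≡holes+filled cs)
length≡holes+filled (just _ ∷ cs)  = trans (cong suc (length≡holes+filled cs)) (sym (+-suc _ _))

count-Sn-extending : ∀ n cs → length cs ≡ n → Unique (catMaybes cs) → All (InRange n) (catMaybes cs) →
                     ∑[ π ← Sn n ] 𝟙 (extends? cs π) ≡ (n ∸ length (catMaybes cs)) !
count-Sn-extending n cs refl uJ rJ = begin
  ∑[ π ← Sn n ] 𝟙 (extends? cs π)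
    ≡⟨ ∑-filter (unique? _≟_) (𝟙 ∘ extends? cs) (words n n) ⟩
  ∑[ w ← words n n ] (𝟙 (unique? _≟_ w) * 𝟙 (extends? cs w))
    ≡⟨ ∑-cong (words n n) (λ {w} _ → trans (sym (𝟙-× (unique? _≟_ w) (extends? cs w)))
                                           (𝟙-cong _ (freshExtension? [] cs w) (fresh-in-empty w))) ⟩
  countFresh n [] cs
    ≡⟨ countFresh≡fallingFactorial n [] cs uJ rJ ⟩
  fallingFactorial (n ∸ length J) (holes cs)
    ≡⟨ cong (fallingFactorial (n ∸ length J)) (trans (sym (m+n∸n≡m (holes cs) (length J)))
                                                     (cong (_∸ length J) (sym (length≡holes+filled cs)))) ⟩
  fallingFactorial (n ∸ length J) (n ∸ length J)
    ≡⟨ fallingFactorial-n-n (n ∸ length J) ⟩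
  (n ∸ length J) ! ∎
  where
  open ≡-Reasoning
  J = catMaybes cs
  fresh-in-empty : ∀ w → (Unique w × Extends cs w) ⇔ FreshExtension [] cs w
  fresh-in-empty w = mk⇔ (λ (u , ext) → u , All.universal (λ _ ()) w , ext) (λ (u , _ , ext) → u , ext)

length-Sn : ∀ n → length (Sn n) ≡ n !
length-Sn n = begin
  length (Sn n)                        ≡⟨ trans (∑-const 1 (Sn n)) (*-identityʳ _) ⟨
  ∑[ π ← Sn n ] 1                      ≡⟨ ∑-cong (Sn n) (λ π∈ → sym (𝟙-yes (extends? blank _) (extends-blank (∈-Sn⁻ π∈)))) ⟩
  ∑[ π ← Sn n ] 𝟙 (extends? blank π)   ≡⟨ count-Sn-extending n blank (length-replicate n)
                                            (subst Unique (sym blank-filled) []) (subst (All (InRange n)) (sym blank-filled) []) ⟩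
  (n ∸ length (catMaybes blank)) !     ≡⟨ cong (λ J → (n ∸ length J) !) blank-filled ⟩
  n !                                  ∎
  where
  open ≡-Reasoning
  blank : Pattern
  blank = replicate n nothing
  blank-filled : catMaybes blank ≡ []
  blank-filled = catMaybes-replicate-nothing n
    where
    catMaybes-replicate-nothing : ∀ m → catMaybes (replicate m nothing) ≡ []
    catMaybes-replicate-nothing zero    = refl
    catMaybes-replicate-nothing (suc m) = catMaybes-replicate-nothing m
  extends-blank : ∀ {w} → IsPermutation n w → Extends blank w
  extends-blank p = subst (λ m → Extends (replicate m nothing) _) (IsPermutation.length≡ p) (everything _)
    where
    everything : ∀ w → Extends (replicate (length w) nothing) w
    everything []      = []
    everything (_ ∷ w) = tt ∷ everything w

-- Iterating a map

-- The iterate f^ is a parameter, given with its defining equations, so that topdrop^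
-- is an instance of this module definitionally.
module Iteration {A : Set} (f : A → A) (f^ : ℕ → A → A)
                 (f^-zero : ∀ x → f^ zero x ≡ x) (f^-suc : ∀ k x → f^ (suc k) x ≡ f^ k (f x)) where

  f^-+ : ∀ a b x → f^ (a + b) x ≡ f^ b (f^ a x)
  f^-+ zero    b x = cong (f^ b) (sym (f^-zero x))
  f^-+ (suc a) b x = begin
    f^ (suc (a + b)) x    ≡⟨ f^-suc (a + b) x ⟩
    f^ (a + b) (f x)      ≡⟨ f^-+ a b (f x) ⟩
    f^ b (f^ a (f x))     ≡⟨ cong (f^ b) (f^-suc a x) ⟨
    f^ b (f^ (suc a) x)   ∎
    where open ≡-Reasoning

  f^-comm : ∀ a b x → f^ a (f^ b x) ≡ f^ b (f^ a x)
  f^-comm a b x = trans (sym (f^-+ b a x)) (trans (cong (λ m → f^ m x) (+-comm b a)) (f^-+ a b x))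

  module _ {s : ℕ} {x : A} (periodic : f^ s x ≡ x) where

    f^-periodic : ∀ q → f^ (q * s) x ≡ x
    f^-periodic zero    = f^-zero x
    f^-periodic (suc q) = trans (f^-+ s (q * s) x) (trans (cong (f^ (q * s)) periodic) (f^-periodic q))

    f^-mod : .{{_ : NonZero s}} → ∀ j → f^ j x ≡ f^ (j % s) x
    f^-mod j = begin
      f^ j x                               ≡⟨ cong (λ m → f^ m x) (m≡m%n+[m/n]*n j s) ⟩
      f^ (j % s + j / s * s) x             ≡⟨ f^-+ (j % s) (j / s * s) x ⟩
      f^ (j / s * s) (f^ (j % s) x)        ≡⟨ f^-comm (j / s * s) (j % s) x ⟩
      f^ (j % s) (f^ (j / s * s) x)        ≡⟨ cong (f^ (j % s)) (f^-periodic (j / s)) ⟩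
      f^ (j % s) x                         ∎
      where open ≡-Reasoning

    f^-return : .{{_ : NonZero s}} → ∀ j → f^ (pred s * j) (f^ j x) ≡ x
    f^-return j = begin
      f^ (pred s * j) (f^ j x)   ≡⟨ f^-+ j (pred s * j) x ⟨
      f^ (j + pred s * j) x      ≡⟨ cong (λ m → f^ m x) (trans (j+[s-1]j≡s*j s) (*-comm s j)) ⟩
      f^ (j * s) x               ≡⟨ f^-periodic j ⟩
      x                          ∎
      where
      open ≡-Reasoning
      j+[s-1]j≡s*j : ∀ s → .{{_ : NonZero s}} → j + pred s * j ≡ s * j
      j+[s-1]j≡s*j (suc s) = refl

  period-divides : ∀ {x t} .{{_ : NonZero t}} → IsLeast (λ s → f^ s x ≡ x) 1 t → ∀ j → f^ j x ≡ x → j % t ≡ 0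
  period-divides {x} {t} l j fj≡x with j % t | m%n<n j t | f^-mod (IsLeast.holds l) j
  ... | zero  | _   | _      = refl
  ... | suc r | r<t | fj≡fr = ⊥-elim (IsLeast.least l (s≤s z≤n) r<t (trans (sym fj≡fr) fj≡x))

  module Cancellative {x : A} (cancel : ∀ i d → f^ i (f^ d x) ≡ f^ i x → f^ d x ≡ x) where

    collision⇒period : ∀ {i j} → i < j → f^ i x ≡ f^ j x → f^ (j ∸ i) x ≡ x
    collision⇒period {i} {j} i<j eq = cancel i (j ∸ i) (begin
      f^ i (f^ (j ∸ i) x)  ≡⟨ f^-+ (j ∸ i) i x ⟨
      f^ (j ∸ i + i) x     ≡⟨ cong (λ m → f^ m x) (m∸n+n≡m (<⇒≤ i<j)) ⟩
      f^ j x               ≡⟨ eq ⟨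
      f^ i x               ∎)
      where open ≡-Reasoning

    iterates-distinct : ∀ {s} → IsLeast (λ s → f^ s x ≡ x) 1 s → ∀ {i j} → i < j → j < s → f^ i x ≢ f^ j x
    iterates-distinct l {i} {j} i<j j<s eq =
      IsLeast.least l (m<n⇒0<n∸m i<j) (≤-<-trans (m∸n≤m j i) j<s) (collision⇒period i<j eq)

-- The topdrop map

IsPermutation-resp-↭ : ∀ {n w v} → w ↭ v → IsPermutation n w → IsPermutation n v
IsPermutation-resp-↭ w↭v p = record
  { length≡ = trans (sym (↭-length w↭v)) length≡
  ; inRange = All-resp-↭ w↭v inRange
  ; unique  = Unique-resp-↭ w↭v unique }
  where open IsPermutation p

topdrop-↭ : ∀ w → topdrop w ↭ w
topdrop-↭ []          = ↭-refl
topdrop-↭ w@(p ∷ _)  = begin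
  drop p w ++ reverse (take p w)  ↭⟨ ++⁺ˡ (drop p w) (↭-reverse (take p w)) ⟩
  drop p w ++ take p w            ↭⟨ ++-comm (drop p w) (take p w) ⟩
  take p w ++ drop p w            ≡⟨ take++drop≡id p w ⟩
  w                               ∎
  where open PermutationReasoning

topdrop-relabel : ∀ g w → g (head0 w) ≡ head0 w → topdrop (map g w) ≡ map g (topdrop w)
topdrop-relabel g []          _     = refl
topdrop-relabel g w@(p ∷ _) gp≡p = begin
  drop (g p) (map g w) ++ reverse (take (g p) (map g w))
    ≡⟨ cong (λ q → drop q (map g w) ++ reverse (take q (map g w))) gp≡p ⟩
  drop p (map g w) ++ reverse (take p (map g w))
    ≡⟨ cong₂ (λ ys zs → ys ++ reverse zs) (drop-map p w) (take-map p w) ⟩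
  map g (drop p w) ++ reverse (map g (take p w))
    ≡⟨ cong (map g (drop p w) ++_) (reverse-map g (take p w)) ⟨
  map g (drop p w) ++ map g (reverse (take p w))
    ≡⟨ map-++ g (drop p w) _ ⟨
  map g (topdrop w) ∎
  where open ≡-Reasoning

++-injective : (as cs : List A) {bs ds : List A} →
               length as ≡ length cs → as ++ bs ≡ cs ++ ds → as ≡ cs × bs ≡ ds
++-injective []       []       _   eq = refl , eq
++-injective (a ∷ as) (c ∷ cs) len eq with refl , eq′ ← ∷-injective eq
                                      with refl , refl ← ++-injective as cs (suc-injective len) eq′ = refl , refl

same-length : ∀ {n w w′} → IsPermutation n w → IsPermutation n w′ → length w ≡ length w′
same-length p p′ = trans (IsPermutation.length≡ p) (sym (IsPermutation.length≡ p′))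

drop-lengths : ∀ q {xs ys : List A} → length xs ≡ length ys → length (drop q xs) ≡ length (drop q ys)
drop-lengths q {xs} {ys} len = trans (length-drop q xs) (trans (cong (_∸ q) len) (sym (length-drop q ys)))

topdrop-∷ʳ : ∀ q rest → topdrop (suc q ∷ rest) ≡ (drop q rest ++ reverse (take q rest)) ∷ʳ suc q
topdrop-∷ʳ q rest = trans (cong (drop q rest ++_) (unfold-reverse (suc q) (take q rest)))
                          (sym (++-assoc (drop q rest) (reverse (take q rest)) [ suc q ]))

topdrop-injective : ∀ {n w w′} → IsPermutation n w → IsPermutation n w′ → topdrop w ≡ topdrop w′ → w ≡ w′
topdrop-injective {w = []}    {[]}    _ _  _ = refl
topdrop-injective {w = []}    {_ ∷ _} p p′ _ with () ← same-length p p′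
topdrop-injective {w = _ ∷ _} {[]}    p p′ _ with () ← same-length p p′
topdrop-injective {w = zero ∷ _}             p _  _ with () ← proj₁ (All.head (IsPermutation.inRange p))
topdrop-injective {w = suc _ ∷ _} {zero ∷ _} _ p′ _ with () ← proj₁ (All.head (IsPermutation.inRange p′))
topdrop-injective {w = suc q ∷ rest} {suc q′ ∷ rest′} p p′ eq
  with body≡ , refl ← ∷ʳ-injective _ _ (trans (sym (topdrop-∷ʳ q rest)) (trans eq (topdrop-∷ʳ q′ rest′)))
  with drop≡ , reverse≡ ←
         ++-injective (drop q rest) (drop q rest′) (drop-lengths q (suc-injective (same-length p p′))) body≡
  = cong (suc q ∷_) (begin
    rest                          ≡⟨ take++drop≡id q rest ⟨
    take q rest ++ drop q rest    ≡⟨ cong₂ _++_ (reverse-injective reverse≡) drop≡ ⟩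
    take q rest′ ++ drop q rest′  ≡⟨ take++drop≡id q rest′ ⟩
    rest′                         ∎)
  where open ≡-Reasoning

open Iteration topdrop topdrop^ (λ _ → refl) (λ _ _ → refl)
  using ()
  renaming (f^-+ to topdrop^-+; f^-comm to topdrop^-comm; f^-mod to topdrop^-mod; f^-return to topdrop^-return;
            module Cancellative to Topdrop^-Cancellative)

topdrop^-↭ : ∀ k w → topdrop^ k w ↭ w
topdrop^-↭ zero    w = ↭-refl
topdrop^-↭ (suc k) w = ↭-trans (topdrop^-↭ k (topdrop w)) (topdrop-↭ w)

IsPermutation-topdrop^ : ∀ {n w} k → IsPermutation n w → IsPermutation n (topdrop^ k w)
IsPermutation-topdrop^ {w = w} k = IsPermutation-resp-↭ (↭-sym (topdrop^-↭ k w))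

topdrop^-injective : ∀ {n w w′} k → IsPermutation n w → IsPermutation n w′ →
                     topdrop^ k w ≡ topdrop^ k w′ → w ≡ w′
topdrop^-injective zero    _ _  eq = eq
topdrop^-injective (suc k) p p′ eq =
  topdrop-injective p p′ (topdrop^-injective k (IsPermutation-topdrop^ 1 p) (IsPermutation-topdrop^ 1 p′) eq)

topdrop^-relabel : ∀ g k w → (∀ {j} → j < k → g (head0 (topdrop^ j w)) ≡ head0 (topdrop^ j w)) →
                   topdrop^ k (map g w) ≡ map g (topdrop^ k w)
topdrop^-relabel g zero    w _      = refl
topdrop^-relabel g (suc k) w fixed = trans (cong (topdrop^ k) (topdrop-relabel g w (fixed (s≤s z≤n))))
                                           (topdrop^-relabel g k (topdrop w) (fixed ∘ s≤s))

-- Orbits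

orbit≡applyUpTo : ∀ π → orbit π ≡ applyUpTo (λ i → topdrop^ i π) (orbitSize π)
orbit≡applyUpTo π = iterate≡applyUpTo π (orbitSize π)
  where
  iterate≡applyUpTo : ∀ w m → iterate topdrop w m ≡ applyUpTo (λ i → topdrop^ i w) m
  iterate≡applyUpTo w zero    = refl
  iterate≡applyUpTo w (suc m) = cong (w ∷_) (iterate≡applyUpTo (topdrop w) m)

∈-orbit⁻ : ∀ {π σ} → σ ∈ orbit π → ∃ λ j → σ ≡ topdrop^ j π
∈-orbit⁻ {π} σ∈ with j , _ , σ≡ ← ∈-applyUpTo⁻ (λ i → topdrop^ i π) (subst (_ ∈_) (orbit≡applyUpTo π) σ∈) =
  j , σ≡

IsOrbitSize : Word → ℕ → Set
IsOrbitSize π = IsLeast (λ s → topdrop^ s π ≡ π) 1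

module _ {n : ℕ} {π : Word} (p : IsPermutation n π) where

  open Topdrop^-Cancellative {π} (λ i d → topdrop^-injective i (IsPermutation-topdrop^ d p) p)

  period-exists : ∃ λ s → 1 ≤ s × s ≤ n ! × topdrop^ s π ≡ π
  period-exists with anyUpTo? (λ s → topdrop^ (suc s) π ≟w π) (n !)
  ... | yes (s , s<n! , return) = suc s , s≤s z≤n , s<n! , return
  ... | no no-return = ⊥-elim (<-irrefl refl (≤-trans too-many (≤-reflexive (length-Sn n))))
    -- pigeonhole: the iterates T^0 π, …, T^(n!) π would be n! + 1 distinct elements of S_n
    where
    distinct : ∀ {i j} → i < j → j < suc (n !) → topdrop^ i π ≢ topdrop^ j π
    distinct {i} {j} i<j (s≤s j≤n!) eq with j ∸ i | m<n⇒0<n∸m i<j | m∸n≤m j i | collision⇒period i<j eq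
    ... | suc d | _ | d<j | return = no-return (d , <-≤-trans d<j j≤n! , return)
    too-many : suc (n !) ≤ length (Sn n)
    too-many = subst (_≤ length (Sn n)) (length-applyUpTo (λ i → topdrop^ i π) (suc (n !)))
      (length-≤-of-⊆ _≟w_ (Unique.applyUpTo⁺₁ (λ i → topdrop^ i π) (suc (n !)) distinct) (Sn-unique n) in-Sn)
      where
      in-Sn : applyUpTo (λ i → topdrop^ i π) (suc (n !)) ⊆ Sn n
      in-Sn σ∈ with i , _ , refl ← ∈-applyUpTo⁻ (λ i → topdrop^ i π) σ∈ = ∈-Sn⁺ (IsPermutation-topdrop^ i p)

  orbitSize-isOrbitSize : IsOrbitSize π (orbitSize π)
  orbitSize-isOrbitSize with s , 1≤s , s≤n! , return ← period-exists =
    proj₁ (search-least (λ s → topdrop^ s π ≟w π) 1 (length π !) 1≤s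
                        (s≤s (subst (λ m → s ≤ m !) (sym (IsPermutation.length≡ p)) s≤n!)) return)

  orbitSize-≡ : ∀ {s} → IsOrbitSize π s → orbitSize π ≡ s
  orbitSize-≡ = IsLeast-unique orbitSize-isOrbitSize

  orbit-unique : Unique (orbit π)
  orbit-unique = subst Unique (sym (orbit≡applyUpTo π))
    (Unique.applyUpTo⁺₁ (λ i → topdrop^ i π) (orbitSize π) (iterates-distinct orbitSize-isOrbitSize))

  orbitSize-positive : 1 ≤ orbitSize π
  orbitSize-positive = IsLeast.lower orbitSize-isOrbitSize

  ∈-orbit⁺ : ∀ j → topdrop^ j π ∈ orbit π
  ∈-orbit⁺ j = subst (topdrop^ j π ∈_) (sym (orbit≡applyUpTo π))
    (subst (_∈ applyUpTo (λ i → topdrop^ i π) s) (sym (topdrop^-mod (IsLeast.holds orbitSize-isOrbitSize) j))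
           (∈-applyUpTo⁺ (λ i → topdrop^ i π) (m%n<n j s)))
    where
    s = orbitSize π
    instance
      _ : NonZero s
      _ = >-nonZero orbitSize-positive

orbitSize-topdrop^ : ∀ {n π} → IsPermutation n π → ∀ i → orbitSize (topdrop^ i π) ≡ orbitSize π
orbitSize-topdrop^ {π = π} p i = orbitSize-≡ (IsPermutation-topdrop^ i p) record
  { lower = IsLeast.lower l
  ; holds = trans (topdrop^-comm (orbitSize π) i π) (cong (topdrop^ i) (IsLeast.holds l))
  ; least = λ {r} 1≤r r<s return → IsLeast.least l 1≤r r<s
      (topdrop^-injective i (IsPermutation-topdrop^ r p) p (trans (topdrop^-comm i r π) return)) }
  where l = orbitSize-isOrbitSize p

SameOrbit-isEquivalence : ∀ {n} → IsEquivalenceOn (IsPermutation n) SameOrbit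
SameOrbit-isEquivalence = record
  { reflexive  = λ p → ∈-orbit⁺ p 0
  ; symmetric  = symmetric
  ; transitive = transitive }
  where
  symmetric : ∀ {n π σ} → IsPermutation n π → IsPermutation n σ → SameOrbit π σ → SameOrbit σ π
  symmetric {π = π} p q σ∈ with j , refl ← ∈-orbit⁻ σ∈ =
    subst (_∈ orbit (topdrop^ j π)) (topdrop^-return {orbitSize π} (IsLeast.holds (orbitSize-isOrbitSize p)) j)
          (∈-orbit⁺ q (pred (orbitSize π) * j))
    where
    instance
      _ : NonZero (orbitSize π)
      _ = >-nonZero (orbitSize-positive p)
  transitive : ∀ {n π σ τ} → IsPermutation n π → IsPermutation n σ → IsPermutation n τ →
               SameOrbit π σ → SameOrbit σ τ → SameOrbit π τ
  transitive {π = π} p _ _ σ∈ τ∈ with i , refl ← ∈-orbit⁻ σ∈ | j , refl ← ∈-orbit⁻ τ∈ =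
    subst (_∈ orbit π) (topdrop^-+ i j π) (∈-orbit⁺ p (i + j))

orbit-class-size : ∀ {n k r} → IsPermutation n r → orbitSize r ≡ k →
                   length (filter (sameOrbit? r) (filter (λ π → orbitSize π ≟ k) (Sn n))) ≡ k
orbit-class-size {n} {k} {r} p size≡k = begin
  length (filter (sameOrbit? r) Lk)  ≡⟨ length-≡-of-same-members unique-class (orbit-unique p) (mk⇔ in-orbit in-class) ⟩
  length (orbit r)                   ≡⟨ length-iterate topdrop r (orbitSize r) ⟩
  orbitSize r                        ≡⟨ size≡k ⟩
  k                                  ∎
  where
  open ≡-Reasoning
  Lk = filter (λ π → orbitSize π ≟ k) (Sn n)
  unique-class : Unique (filter (sameOrbit? r) Lk)
  unique-class = Unique.filter⁺ (sameOrbit? r) (Unique.filter⁺ (λ π → orbitSize π ≟ k) (Sn-unique n))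
  in-orbit : ∀ {σ} → σ ∈ filter (sameOrbit? r) Lk → σ ∈ orbit r
  in-orbit = proj₂ ∘ ∈-filter⁻ (sameOrbit? r) {xs = Lk}
  in-class : ∀ {σ} → σ ∈ orbit r → σ ∈ filter (sameOrbit? r) Lk
  in-class σ∈ with j , refl ← ∈-orbit⁻ σ∈ =
    ∈-filter⁺ (sameOrbit? r) (∈-filter⁺ (λ π → orbitSize π ≟ k) (∈-Sn⁺ (IsPermutation-topdrop^ j p))
                                         (trans (orbitSize-topdrop^ p j) size≡k)) σ∈

-- Rotations

rotateLeft : List A → List A
rotateLeft []       = []
rotateLeft (x ∷ xs) = xs ++ [ x ]

rotateLeft^ : ℕ → List A → List A
rotateLeft^ zero    xs = xs
rotateLeft^ (suc k) xs = rotateLeft^ k (rotateLeft xs)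

open Iteration (rotateLeft {ℕ}) rotateLeft^ (λ _ → refl) (λ _ _ → refl)
  using ()
  renaming (f^-+ to rotateLeft^-+; f^-mod to rotateLeft^-mod; f^-return to rotateLeft^-return;
            period-divides to rotation-period-divides; module Cancellative to RotateLeft^-Cancellative)

rotateLeft^-↭ : ∀ j (xs : List A) → rotateLeft^ j xs ↭ xs
rotateLeft^-↭ zero    xs       = ↭-refl
rotateLeft^-↭ (suc j) []       = rotateLeft^-↭ j []
rotateLeft^-↭ (suc j) (x ∷ xs) = ↭-trans (rotateLeft^-↭ j (xs ++ [ x ])) (++-comm xs [ x ])

length-rotateLeft^ : ∀ j (xs : List A) → length (rotateLeft^ j xs) ≡ length xs
length-rotateLeft^ j xs = ↭-length (rotateLeft^-↭ j xs)

rotateLeft^-injective : ∀ j {xs ys : List A} → rotateLeft^ j xs ≡ rotateLeft^ j ys → xs ≡ ys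
rotateLeft^-injective zero    eq = eq
rotateLeft^-injective (suc j) {xs} {ys} eq = rotateLeft-injective xs ys (rotateLeft^-injective j eq)
  where
  rotateLeft-injective : ∀ xs ys → rotateLeft xs ≡ rotateLeft ys → xs ≡ ys
  rotateLeft-injective []       []       _  = refl
  rotateLeft-injective (x ∷ xs) (y ∷ ys) eq with refl , refl ← ∷ʳ-injective xs ys eq = refl
  rotateLeft-injective []       (y ∷ ys) eq with () ← ++-conicalʳ ys [ y ] (sym eq)
  rotateLeft-injective (x ∷ xs) []       eq with () ← ++-conicalʳ xs [ x ] eq

rotate≡rotateLeft^ : ∀ j (xs : List ℕ) → j ≤ length xs → rotate j xs ≡ rotateLeft^ j xs
rotate≡rotateLeft^ zero    xs       _         = ++-identityʳ xs
rotate≡rotateLeft^ (suc j) (x ∷ xs) (s≤s j≤n) = begin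
  drop j xs ++ x ∷ take j xs                     ≡⟨ ++-assoc (drop j xs) [ x ] (take j xs) ⟨
  (drop j xs ++ [ x ]) ++ take j xs              ≡⟨ cong₂ _++_ (drop-++ j xs j≤n) (take-++ j xs j≤n) ⟨
  drop j (xs ++ [ x ]) ++ take j (xs ++ [ x ])
    ≡⟨ rotate≡rotateLeft^ j (xs ++ [ x ]) (subst (j ≤_) (sym (length-++ xs)) (m≤n⇒m≤n+o 1 j≤n)) ⟩
  rotateLeft^ j (xs ++ [ x ])                    ∎
  where
  open ≡-Reasoning
  drop-++ : ∀ j xs {ys : List A} → j ≤ length xs → drop j (xs ++ ys) ≡ drop j xs ++ ys
  drop-++ zero    xs       _         = refl
  drop-++ (suc j) (x ∷ xs) (s≤s j≤n) = drop-++ j xs j≤n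
  take-++ : ∀ j xs {ys : List A} → j ≤ length xs → take j (xs ++ ys) ≡ take j xs
  take-++ zero    xs       _         = refl
  take-++ (suc j) (x ∷ xs) (s≤s j≤n) = cong (x ∷_) (take-++ j xs j≤n)

rotateLeft^-length : ∀ (xs : List ℕ) → rotateLeft^ (length xs) xs ≡ xs
rotateLeft^-length xs = begin
  rotateLeft^ (length xs) xs                      ≡⟨ rotate≡rotateLeft^ (length xs) xs ≤-refl ⟨
  drop (length xs) xs ++ take (length xs) xs
    ≡⟨ cong₂ _++_ (drop-all (length xs) xs ≤-refl) (take-all (length xs) xs ≤-refl) ⟩
  xs                                              ∎
  where open ≡-Reasoning

RotEq⇔ : ∀ {xs ys} → 1 ≤ length xs → RotEq xs ys ⇔ (∃ λ j → rotateLeft^ j xs ≡ ys)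
RotEq⇔ {xs} {ys} nonempty = mk⇔ to from
  where
  instance
    _ : NonZero (length xs)
    _ = >-nonZero nonempty
  to : RotEq xs ys → ∃ λ j → rotateLeft^ j xs ≡ ys
  to r with j , j∈ , eq ← find r = j , trans (sym (rotate≡rotateLeft^ j xs (<⇒≤ (∈-upTo⁻ j∈)))) eq
  from : (∃ λ j → rotateLeft^ j xs ≡ ys) → RotEq xs ys
  from (j , eq) = lose (∈-upTo⁺ (m%n<n j (length xs)))
    (trans (rotate≡rotateLeft^ (j % length xs) xs (<⇒≤ (m%n<n j (length xs))))
           (trans (sym (rotateLeft^-mod (rotateLeft^-length xs) j)) eq))

RotEq-isEquivalence : IsEquivalenceOn (λ xs → 1 ≤ length xs) RotEq
RotEq-isEquivalence = record
  { reflexive  = λ ok → Equivalence.from (RotEq⇔ ok) (0 , refl)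
  ; symmetric  = symmetric
  ; transitive = λ okx oky _ r₁ r₂ → transitive okx oky r₁ r₂ }
  where
  symmetric : ∀ {xs ys} → 1 ≤ length xs → 1 ≤ length ys → RotEq xs ys → RotEq ys xs
  symmetric {xs} okx oky r with j , refl ← Equivalence.to (RotEq⇔ okx) r =
    Equivalence.from (RotEq⇔ oky) (pred (length xs) * j , rotateLeft^-return {length xs} (rotateLeft^-length xs) j)
    where
    instance
      _ : NonZero (length xs)
      _ = >-nonZero okx
  transitive : ∀ {xs ys zs} → 1 ≤ length xs → 1 ≤ length ys → RotEq xs ys → RotEq ys zs → RotEq xs zs
  transitive {xs} okx oky r₁ r₂
    with i , refl ← Equivalence.to (RotEq⇔ okx) r₁ | j , refl ← Equivalence.to (RotEq⇔ oky) r₂ =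
    Equivalence.from (RotEq⇔ okx) (i + j , rotateLeft^-+ i j xs)

distinctVals-↭ : ∀ {xs ys} → xs ↭ ys → distinctVals xs ≡ distinctVals ys
distinctVals-↭ {xs} {ys} xs↭ys = length-≡-of-same-members (deduplicate-! _≟_ xs) (deduplicate-! _≟_ ys)
  (mk⇔ (∈-deduplicate⁺ _≟_ ∘ ∈-resp-↭ xs↭ys ∘ ∈-deduplicate⁻ _≟_ xs)
       (∈-deduplicate⁺ _≟_ ∘ ∈-resp-↭ (↭-sym xs↭ys) ∘ ∈-deduplicate⁻ _≟_ ys))

-- Necklace sequences

applyUpTo-≡⇔ : ∀ {f f′ : ℕ → A} m → applyUpTo f m ≡ applyUpTo f′ m ⇔ (∀ {i} → i < m → f i ≡ f′ i)
applyUpTo-≡⇔ m = mk⇔ (to m) (from m)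
  where
  to : ∀ {f f′ : ℕ → _} m → applyUpTo f m ≡ applyUpTo f′ m → ∀ {i} → i < m → f i ≡ f′ i
  to (suc m) eq {zero}  _         = proj₁ (∷-injective eq)
  to (suc m) eq {suc i} (s≤s i<m) = to m (proj₂ (∷-injective eq)) i<m
  from : ∀ {f f′ : ℕ → _} m → (∀ {i} → i < m → f i ≡ f′ i) → applyUpTo f m ≡ applyUpTo f′ m
  from zero    _  = refl
  from (suc m) f≗ = cong₂ _∷_ (f≗ (s≤s z≤n)) (from m (f≗ ∘ s≤s))

applyUpTo-suc≡rotateLeft : ∀ (h : ℕ → A) s → h s ≡ h 0 → applyUpTo (h ∘ suc) s ≡ rotateLeft (applyUpTo h s)
applyUpTo-suc≡rotateLeft h zero    _      = refl
applyUpTo-suc≡rotateLeft h (suc s) hs≡h0 =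
  trans (sym (applyUpTo-∷ʳ (h ∘ suc) s)) (cong (applyUpTo (h ∘ suc) s ∷ʳ_) hs≡h0)

necklaceSeq≡applyUpTo : ∀ π → necklaceSeq π ≡ applyUpTo (λ i → head0 (topdrop^ i π)) (orbitSize π)
necklaceSeq≡applyUpTo π =
  trans (cong (map head0) (orbit≡applyUpTo π)) (map-applyUpTo (λ i → topdrop^ i π) head0 (orbitSize π))

length-necklaceSeq : ∀ π → length (necklaceSeq π) ≡ orbitSize π
length-necklaceSeq π = trans (length-map head0 (orbit π)) (length-iterate topdrop π (orbitSize π))

necklaceSeq-topdrop : ∀ {n τ} → IsPermutation n τ → necklaceSeq (topdrop τ) ≡ rotateLeft (necklaceSeq τ)
necklaceSeq-topdrop {τ = τ} p = begin
  necklaceSeq (topdrop τ)                      ≡⟨ necklaceSeq≡applyUpTo (topdrop τ) ⟩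
  applyUpTo (h ∘ suc) (orbitSize (topdrop τ))  ≡⟨ cong (applyUpTo (h ∘ suc)) (orbitSize-topdrop^ p 1) ⟩
  applyUpTo (h ∘ suc) (orbitSize τ)
    ≡⟨ applyUpTo-suc≡rotateLeft h (orbitSize τ) (cong head0 (IsLeast.holds (orbitSize-isOrbitSize p))) ⟩
  rotateLeft (applyUpTo h (orbitSize τ))       ≡⟨ cong rotateLeft (necklaceSeq≡applyUpTo τ) ⟨
  rotateLeft (necklaceSeq τ)                   ∎
  where
  open ≡-Reasoning
  h : ℕ → ℕ
  h i = head0 (topdrop^ i τ)

necklaceSeq-topdrop^ : ∀ {n τ} → IsPermutation n τ → ∀ j →
                       necklaceSeq (topdrop^ j τ) ≡ rotateLeft^ j (necklaceSeq τ)
necklaceSeq-topdrop^ p zero    = refl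
necklaceSeq-topdrop^ p (suc j) =
  trans (necklaceSeq-topdrop^ (IsPermutation-topdrop^ 1 p) j) (cong (rotateLeft^ j) (necklaceSeq-topdrop p))

∈-necklaceSeq⁻ : ∀ {σ u} → u ∈ necklaceSeq σ → ∃ λ j → j < orbitSize σ × u ≡ head0 (topdrop^ j σ)
∈-necklaceSeq⁻ {σ} u∈ = ∈-applyUpTo⁻ (λ i → head0 (topdrop^ i σ)) (subst (_ ∈_) (necklaceSeq≡applyUpTo σ) u∈)

necklaceSeq-⊆ : ∀ {n σ} → IsPermutation (suc n) σ → necklaceSeq σ ⊆ σ
necklaceSeq-⊆ {σ = σ} p u∈ with j , _ , refl ← ∈-necklaceSeq⁻ u∈ =
  ∈-resp-↭ (topdrop^-↭ j σ) (head0-∈ {topdrop^ j σ} (IsPermutation.length≡ (IsPermutation-topdrop^ j p)))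
  where
  head0-∈ : ∀ {w m} → length w ≡ suc m → head0 w ∈ w
  head0-∈ {_ ∷ _} _ = here refl

-- Fibres of the necklace map

relabel : Word → Word → ℕ → ℕ
relabel []       _        v = v
relabel (_ ∷ _)  []       v = v
relabel (a ∷ as) (b ∷ bs) v with v ≟ a
... | yes _ = b
... | no  _ = relabel as bs v

map-relabel : ∀ {σ π} → Unique σ → length σ ≡ length π → map (relabel σ π) σ ≡ π
map-relabel {[]}    {[]}    _          _   = refl
map-relabel {a ∷ σ} {b ∷ π} (a∉σ ∷ uσ) len with a ≟ a
... | no a≢a = ⊥-elim (a≢a refl)
... | yes _  = cong (b ∷_) (trans (map-cong-local (All.map skip-a a∉σ)) (map-relabel uσ (suc-injective len)))
  where
  skip-a : ∀ {v} → a ≢ v → relabel (a ∷ σ) (b ∷ π) v ≡ relabel σ π v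
  skip-a {v} a≢v with v ≟ a
  ... | yes v≡a = ⊥-elim (a≢v (sym v≡a))
  ... | no _    = refl

map-injectiveOn : ∀ {g : A → B} {xs} → Unique (map g xs) → ∀ {u v} → u ∈ xs → v ∈ xs → g u ≡ g v → u ≡ v
map-injectiveOn _          (here refl) (here refl) _  = refl
map-injectiveOn (gx∉ ∷ _)  (here refl) (there v∈)  eq = ⊥-elim (All.lookup gx∉ (∈-map⁺ _ v∈) eq)
map-injectiveOn (gx∉ ∷ _)  (there u∈)  (here refl) eq = ⊥-elim (All.lookup gx∉ (∈-map⁺ _ u∈) (sym eq))
map-injectiveOn (_ ∷ ugxs) (there u∈)  (there v∈)  eq = map-injectiveOn ugxs u∈ v∈ eq

map-cancelOn : ∀ {g : A → B} {ys} → (∀ {u v} → u ∈ ys → v ∈ ys → g u ≡ g v → u ≡ v) →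
               ∀ {w₁ w₂} → All (_∈ ys) w₁ → All (_∈ ys) w₂ → map g w₁ ≡ map g w₂ → w₁ ≡ w₂
map-cancelOn inj []         []         _  = refl
map-cancelOn inj (u∈ ∷ us∈) (v∈ ∷ vs∈) eq with gu≡gv , eq′ ← ∷-injective eq =
  cong₂ _∷_ (inj u∈ v∈ gu≡gv) (map-cancelOn inj us∈ vs∈ eq′)

keep : List ℕ → ℕ → Maybe ℕ
keep x v with v ∈ℕ? x
... | yes _ = just v
... | no  _ = nothing

extends-keep⇔ : ∀ x σ g → Extends (map (keep x) σ) (map g σ) ⇔ (∀ {u} → u ∈ σ → u ∈ x → g u ≡ u)
extends-keep⇔ x σ g = mk⇔ (to σ) (from σ)
  where
  to : ∀ σ → Extends (map (keep x) σ) (map g σ) → ∀ {u} → u ∈ σ → u ∈ x → g u ≡ u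
  to (v ∷ σ) (fits ∷ _) (here refl) v∈x with v ∈ℕ? x | fits
  ... | yes _   | v≡gv = sym v≡gv
  ... | no v∉x  | _    = ⊥-elim (v∉x v∈x)
  to (v ∷ σ) (_ ∷ ext) (there u∈) u∈x = to σ ext u∈ u∈x
  from : ∀ σ → (∀ {u} → u ∈ σ → u ∈ x → g u ≡ u) → Extends (map (keep x) σ) (map g σ)
  from []      _     = []
  from (v ∷ σ) fixes = fits-v ∷ from σ (fixes ∘ there)
    where
    fits-v : Fits (keep x v) (g v)
    fits-v with v ∈ℕ? x
    ... | yes v∈x = sym (fixes (here refl) v∈x)
    ... | no _    = tt

catMaybes-keep : ∀ x σ → catMaybes (map (keep x) σ) ≡ filter (_∈ℕ? x) σ
catMaybes-keep x []      = refl
catMaybes-keep x (v ∷ σ) with v ∈ℕ? x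
... | yes _ = cong (v ∷_) (catMaybes-keep x σ)
... | no  _ = catMaybes-keep x σ

head0-map : ∀ g {w m} → length w ≡ suc m → head0 (map g w) ≡ g (head0 w)
head0-map g {_ ∷ _} _ = refl

-- With g the relabelling such that g ∘ σ = π, topdrop commutes with g along the orbit of σ as
-- long as g fixes the first entries met so far; so π has the necklace sequence of σ iff g fixes
-- all its values, i.e. iff π agrees with σ wherever σ holds one of them.
module Fibre {n : ℕ} {σ π : Word} (pσ : IsPermutation (suc n) σ) (pπ : IsPermutation (suc n) π) where

  private
    g : ℕ → ℕ
    g = relabel σ π
    s : ℕ
    s = orbitSize σ
    h : ℕ → ℕ
    h i = head0 (topdrop^ i σ)
    x : List ℕ
    x = necklaceSeq σ

    σ-period : IsOrbitSize σ s
    σ-period = orbitSize-isOrbitSize pσ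

    relabels-σ : map g σ ≡ π
    relabels-σ = map-relabel (IsPermutation.unique pσ) (same-length pσ pπ)

    FixesHeads : ℕ → Set
    FixesHeads i = ∀ {j} → j < i → g (h j) ≡ h j

    track : ∀ {i} → FixesHeads i → topdrop^ i π ≡ map g (topdrop^ i σ)
    track {i} fixed = trans (cong (topdrop^ i) (sym relabels-σ)) (topdrop^-relabel g i σ fixed)

    head-track : ∀ {i} → FixesHeads i → head0 (topdrop^ i π) ≡ g (h i)
    head-track {i} fixed = trans (cong head0 (track fixed))
      (head0-map g {topdrop^ i σ} (IsPermutation.length≡ (IsPermutation-topdrop^ i pσ)))

    heads-agree : ∀ {i} → FixesHeads s → i < s → head0 (topdrop^ i π) ≡ h i
    heads-agree fixed i<s = trans (head-track (fixed ∘ (λ j<i → <-trans j<i i<s))) (fixed i<s)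

    fixes⇒orbitSize : FixesHeads s → orbitSize π ≡ s
    fixes⇒orbitSize fixed = orbitSize-≡ pπ record
      { lower = IsLeast.lower σ-period
      ; holds = trans (track fixed) (trans (cong (map g) (IsLeast.holds σ-period)) relabels-σ)
      ; least = λ {r} 1≤r r<s return → IsLeast.least σ-period 1≤r r<s
          (map-cancelOn injective (entries r) (entries 0)
            (trans (sym (track (fixed ∘ (λ j<r → <-trans j<r r<s)))) (trans return (sym relabels-σ)))) }
      where
      injective : ∀ {u v} → u ∈ σ → v ∈ σ → g u ≡ g v → u ≡ v
      injective = map-injectiveOn (subst Unique (sym relabels-σ) (IsPermutation.unique pπ))
      entries : ∀ r → All (_∈ σ) (topdrop^ r σ)
      entries r = All.tabulate (∈-resp-↭ (topdrop^-↭ r σ))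

    same-necklace : FixesHeads s → necklaceSeq π ≡ x
    same-necklace fixed = begin
      necklaceSeq π                                          ≡⟨ necklaceSeq≡applyUpTo π ⟩
      applyUpTo (λ i → head0 (topdrop^ i π)) (orbitSize π)
        ≡⟨ cong (applyUpTo (λ i → head0 (topdrop^ i π))) (fixes⇒orbitSize fixed) ⟩
      applyUpTo (λ i → head0 (topdrop^ i π)) s
        ≡⟨ Equivalence.from (applyUpTo-≡⇔ s) (heads-agree fixed) ⟩
      applyUpTo h s                                          ≡⟨ necklaceSeq≡applyUpTo σ ⟨
      x                                                      ∎
      where open ≡-Reasoning

    same-necklace⇒fixes : necklaceSeq π ≡ x → FixesHeads s
    same-necklace⇒fixes eq = fixes-upto s ≤-refl
      where
      sizes : orbitSize π ≡ s
      sizes = trans (sym (length-necklaceSeq π)) (trans (cong length eq) (length-necklaceSeq σ))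
      heads : ∀ {i} → i < s → head0 (topdrop^ i π) ≡ h i
      heads = Equivalence.to (applyUpTo-≡⇔ s)
        (trans (subst (λ m → applyUpTo (λ i → head0 (topdrop^ i π)) m ≡ necklaceSeq π) sizes
                      (sym (necklaceSeq≡applyUpTo π)))
               (trans eq (necklaceSeq≡applyUpTo σ)))
      fixes-upto : ∀ i → i ≤ s → FixesHeads i
      fixes-upto (suc i) i<s {j} (s≤s j≤i) with m≤n⇒m<n∨m≡n j≤i
      ... | inj₁ j<i  = fixes-upto i (<⇒≤ i<s) j<i
      ... | inj₂ refl = trans (sym (head-track (fixes-upto i (<⇒≤ i<s)))) (heads i<s)

    fixes⇔extends : FixesHeads s ⇔ Extends (map (keep x) σ) π
    fixes⇔extends = mk⇔ to from
      where
      h∈x : ∀ {j} → j < s → h j ∈ x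
      h∈x {j} j<s = subst (h j ∈_) (sym (necklaceSeq≡applyUpTo σ)) (∈-applyUpTo⁺ h j<s)
      to : FixesHeads s → Extends (map (keep x) σ) π
      to fixed = subst (Extends (map (keep x) σ)) relabels-σ (Equivalence.from (extends-keep⇔ x σ g) fixes-x)
        where
        fixes-x : ∀ {u} → u ∈ σ → u ∈ x → g u ≡ u
        fixes-x _ u∈x with j , j<s , refl ← ∈-necklaceSeq⁻ u∈x = fixed j<s
      from : Extends (map (keep x) σ) π → FixesHeads s
      from ext j<s = Equivalence.to (extends-keep⇔ x σ g) (subst (Extends (map (keep x) σ)) (sym relabels-σ) ext)
        (necklaceSeq-⊆ pσ (h∈x j<s)) (h∈x j<s)

  fibre⇔ : necklaceSeq π ≡ necklaceSeq σ ⇔ Extends (map (keep (necklaceSeq σ)) σ) π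
  fibre⇔ = mk⇔ (Equivalence.to fixes⇔extends ∘ same-necklace⇒fixes)
               (same-necklace ∘ Equivalence.from fixes⇔extends)

fibre-size : ∀ {n σ} → IsPermutation n σ →
             ∑[ π ← Sn n ] 𝟙 (necklaceSeq π ≟w necklaceSeq σ) ≡ (n ∸ distinctVals (necklaceSeq σ)) !
fibre-size {zero}  {[]} _  = refl  -- S_0 = {[]}, and both sides compute to 1
fibre-size {suc n} {σ}  pσ = begin
  ∑[ π ← Sn (suc n) ] 𝟙 (necklaceSeq π ≟w x)
    ≡⟨ ∑-cong (Sn (suc n)) (λ {π} π∈ → 𝟙-cong (necklaceSeq π ≟w x) (extends? cs π)
                                                  (Fibre.fibre⇔ pσ (∈-Sn⁻ π∈))) ⟩
  ∑[ π ← Sn (suc n) ] 𝟙 (extends? cs π)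
    ≡⟨ count-Sn-extending (suc n) cs (trans (length-map (keep x) σ) (IsPermutation.length≡ pσ))
                          (subst Unique (sym J≡) uniqueJ) (subst (All (InRange (suc n))) (sym J≡) inRangeJ) ⟩
  (suc n ∸ length (catMaybes cs)) !
    ≡⟨ cong (λ J → (suc n ∸ length J) !) J≡ ⟩
  (suc n ∸ length (filter (_∈ℕ? x) σ)) !
    ≡⟨ cong (λ m → (suc n ∸ m) !) (length-≡-of-same-members uniqueJ (deduplicate-! _≟_ x) (mk⇔ J⊆ ⊆J)) ⟩
  (suc n ∸ distinctVals x) ! ∎
  where
  open ≡-Reasoning
  x = necklaceSeq σ
  cs = map (keep x) σ
  J≡ = catMaybes-keep x σ
  uniqueJ = Unique.filter⁺ (_∈ℕ? x) (IsPermutation.unique pσ)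
  inRangeJ = All.filter⁺ (_∈ℕ? x) (IsPermutation.inRange pσ)
  J⊆ : ∀ {v} → v ∈ filter (_∈ℕ? x) σ → v ∈ deduplicate _≟_ x
  J⊆ = ∈-deduplicate⁺ _≟_ ∘ proj₂ ∘ ∈-filter⁻ (_∈ℕ? x) {xs = σ}
  ⊆J : ∀ {v} → v ∈ deduplicate _≟_ x → v ∈ filter (_∈ℕ? x) σ
  ⊆J v∈ with v∈x ← ∈-deduplicate⁻ _≟_ x v∈ = ∈-filter⁺ (_∈ℕ? x) (necklaceSeq-⊆ pσ v∈x) v∈x

-- Rotation classes

IsLeast-cong : ∀ {P Q : ℕ → Set} {lo r} → (∀ {j} → j ≤ r → P j ⇔ Q j) → IsLeast P lo r → IsLeast Q lo r
IsLeast-cong P⇔Q l = record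
  { lower = IsLeast.lower l
  ; holds = Equivalence.to (P⇔Q ≤-refl) (IsLeast.holds l)
  ; least = λ lo≤j j<r → IsLeast.least l lo≤j j<r ∘ Equivalence.from (P⇔Q (<⇒≤ j<r)) }

length≡period*suc : ∀ xs {t} → leastShift xs ≡ suc t → length xs % suc t ≡ 0 →
                    length xs ≡ period xs * suc t
length≡period*suc xs {t} eq divides = begin
  length xs                                         ≡⟨ m≡m%n+[m/n]*n (length xs) (suc t) ⟩
  length xs % suc t + length xs / suc t * suc t     ≡⟨ cong (_+ length xs / suc t * suc t) divides ⟩
  length xs / suc t * suc t                         ≡⟨ cong (_* suc t) (period≡ xs eq) ⟨
  period xs * suc t                                 ∎
  where
  open ≡-Reasoning
  period≡ : ∀ xs {t} → leastShift xs ≡ suc t → period xs ≡ length xs / suc t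
  period≡ xs eq rewrite eq = refl

module RotationClass (N : List ℕ) (nonempty : 1 ≤ length N) where

  leastShift-isLeast : IsLeast (λ j → rotateLeft^ j N ≡ N) 1 (leastShift N)
  leastShift-isLeast with l , t≤L ← search-least (λ j → rotate j N ≟w N) 1 (length N) nonempty ≤-refl
                                        (trans (rotate≡rotateLeft^ (length N) N ≤-refl) (rotateLeft^-length N))
    = IsLeast-cong (λ {j} j≤t → mk⇔ (trans (sym (rotate≡rotateLeft^ j N (≤-trans j≤t t≤L))))
                                    (trans (rotate≡rotateLeft^ j N (≤-trans j≤t t≤L)))) l

  private
    t = leastShift N
    instance
      _ : NonZero t
      _ = >-nonZero (IsLeast.lower leastShift-isLeast)

  length≡period*leastShift : length N ≡ period N * t
  length≡period*leastShift =
    trans (length≡period*suc N t≡ divides) (cong (period N *_) (sym t≡))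
    where
    t≡ : t ≡ suc (pred t)
    t≡ = sym (suc-pred t)
    divides : length N % suc (pred t) ≡ 0
    divides = rotation-period-divides (subst (IsLeast _ 1) t≡ leastShift-isLeast)
                                      (length N) (rotateLeft^-length N)

  rotations-distinct : ∀ {i j} → i < j → j < t → rotateLeft^ i N ≢ rotateLeft^ j N
  rotations-distinct =
    RotateLeft^-Cancellative.iterates-distinct (λ i _ → rotateLeft^-injective i) leastShift-isLeast

  rotation-index-unique : ∀ {i j} → i < t → j < t → rotateLeft^ i N ≡ rotateLeft^ j N → i ≡ j
  rotation-index-unique {i} {j} i<t j<t eq with <-cmp i j
  ... | tri< i<j _ _ = ⊥-elim (rotations-distinct i<j j<t eq)
  ... | tri≈ _ i≡j _ = i≡j
  ... | tri> _ _ j<i = ⊥-elim (rotations-distinct j<i i<t (sym eq))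

  𝟙-RotEq≡∑ : ∀ y → 𝟙 (rotEq? N y) ≡ ∑[ j ← upTo t ] 𝟙 (y ≟w rotateLeft^ j N)
  𝟙-RotEq≡∑ y with rotEq? N y
  ... | yes r with j , refl ← Equivalence.to (RotEq⇔ nonempty) r = sym (begin
    ∑[ i ← upTo t ] 𝟙 (hit? i)  ≡⟨ length-filter≡∑𝟙 hit? (upTo t) ⟨
    length (filter hit? (upTo t))  ≡⟨ length-≡-of-same-members (Unique.filter⁺ hit? (Unique.upTo⁺ t)) ([] ∷ [])
                                        (mk⇔ only-j′ λ { (here refl) → j′-hits }) ⟩
    1                              ∎)
    where
    open ≡-Reasoning
    hit? : ∀ i → Dec (rotateLeft^ j N ≡ rotateLeft^ i N)
    hit? i = rotateLeft^ j N ≟w rotateLeft^ i N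
    j′ = j % t
    j′-hits : j′ ∈ filter hit? (upTo t)
    j′-hits = ∈-filter⁺ hit? (∈-upTo⁺ (m%n<n j t)) (rotateLeft^-mod (IsLeast.holds leastShift-isLeast) j)
    only-j′ : ∀ {i} → i ∈ filter hit? (upTo t) → i ∈ [ j′ ]
    only-j′ i∈ with i∈upTo , j≈i ← ∈-filter⁻ hit? {xs = upTo t} i∈ =
      here (rotation-index-unique (∈-upTo⁻ i∈upTo) (m%n<n j t)
                                  (trans (sym j≈i) (rotateLeft^-mod (IsLeast.holds leastShift-isLeast) j)))
  ... | no ¬r = sym (trans (∑-cong (upTo t) (λ {i} _ → 𝟙-no (y ≟w rotateLeft^ i N)
                                     (λ y≡ → ¬r (Equivalence.from (RotEq⇔ nonempty) (i , sym y≡)))))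
                           (trans (∑-const 0 (upTo t)) (*-zeroʳ (length (upTo t)))))

necklaceSeq-nonempty : ∀ {n σ} → IsPermutation n σ → 1 ≤ length (necklaceSeq σ)
necklaceSeq-nonempty {σ = σ} p = subst (1 ≤_) (sym (length-necklaceSeq σ)) (orbitSize-positive p)

necklaceClassSize : ℕ → List ℕ → ℕ
necklaceClassSize n N = leastShift N * (n ∸ distinctVals N) !

rotation-class-size : ∀ {n σ} → IsPermutation n σ →
  ∑[ π ← Sn n ] 𝟙 (rotEq? (necklaceSeq σ) (necklaceSeq π)) ≡ necklaceClassSize n (necklaceSeq σ)
rotation-class-size {n} {σ} p = begin
  ∑[ π ← Sn n ] 𝟙 (rotEq? N (necklaceSeq π))
    ≡⟨ ∑-cong (Sn n) (λ {π} _ → 𝟙-RotEq≡∑ (necklaceSeq π)) ⟩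
  ∑[ π ← Sn n ] ∑[ j ← upTo t ] 𝟙 (necklaceSeq π ≟w rotateLeft^ j N)
    ≡⟨ ∑-comm (λ π j → 𝟙 (necklaceSeq π ≟w rotateLeft^ j N)) (Sn n) (upTo t) ⟩
  ∑[ j ← upTo t ] ∑[ π ← Sn n ] 𝟙 (necklaceSeq π ≟w rotateLeft^ j N)
    ≡⟨ ∑-cong (upTo t) (λ {j} _ → fibre-of-rotation j) ⟩
  ∑[ j ← upTo t ] ((n ∸ distinctVals N) !)
    ≡⟨ ∑-const ((n ∸ distinctVals N) !) (upTo t) ⟩
  length (upTo t) * (n ∸ distinctVals N) !
    ≡⟨ cong (_* (n ∸ distinctVals N) !) (length-upTo t) ⟩
  t * (n ∸ distinctVals N) ! ∎
  where
  open ≡-Reasoning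
  N = necklaceSeq σ
  open RotationClass N (necklaceSeq-nonempty p)
  t = leastShift N
  fibre-of-rotation : ∀ j → ∑[ π ← Sn n ] 𝟙 (necklaceSeq π ≟w rotateLeft^ j N) ≡ (n ∸ distinctVals N) !
  fibre-of-rotation j = begin
    ∑[ π ← Sn n ] 𝟙 (necklaceSeq π ≟w rotateLeft^ j N)
      ≡⟨ cong (λ y → ∑[ π ← Sn n ] 𝟙 (necklaceSeq π ≟w y)) (necklaceSeq-topdrop^ p j) ⟨
    ∑[ π ← Sn n ] 𝟙 (necklaceSeq π ≟w necklaceSeq (topdrop^ j σ))
      ≡⟨ fibre-size (IsPermutation-topdrop^ j p) ⟩
    (n ∸ distinctVals (necklaceSeq (topdrop^ j σ))) !
      ≡⟨ cong (λ m → (n ∸ m) !) (trans (cong distinctVals (necklaceSeq-topdrop^ p j))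
                                       (distinctVals-↭ (rotateLeft^-↭ j N))) ⟩
    (n ∸ distinctVals N) ! ∎

-- Fractions with natural numerator and positive denominator

frac-cross : ∀ a p b q → a * suc q ≡ b * suc p → frac a (suc p) ≡ frac b (suc q)
frac-cross a p b q eq = ℚ.fromℚᵘ-cong {mkℚᵘ (+ a) p} {mkℚᵘ (+ b) q}
  (*≡* (trans (sym (ℤ.pos-* a (suc q))) (trans (cong +_ eq) (ℤ.pos-* b (suc p)))))

+ᵘ-same-denominator : ∀ a b p → mkℚᵘ (+ a) p +ᵘ mkℚᵘ (+ b) p ≃ᵘ mkℚᵘ (+ (a + b)) p
+ᵘ-same-denominator a b p = *≡* (begin
  (+ a ℤ* + suc p ℤ+ + b ℤ* + suc p) ℤ* + suc p
    ≡⟨ cong (_ℤ* + suc p) (cong₂ _ℤ+_ (ℤ.pos-* a (suc p)) (ℤ.pos-* b (suc p))) ⟨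
  + (a * suc p + b * suc p) ℤ* + suc p            ≡⟨ ℤ.pos-* (a * suc p + b * suc p) (suc p) ⟨
  + ((a * suc p + b * suc p) * suc p)             ≡⟨ cong +_ (trans (cong (_* suc p) (sym (*-distribʳ-+ (suc p) a b)))
                                                                   (*-assoc (a + b) (suc p) (suc p))) ⟩
  + ((a + b) * (suc p * suc p))                   ≡⟨ ℤ.pos-* (a + b) (suc p * suc p) ⟩
  + (a + b) ℤ* + (suc p * suc p)                  ≡⟨ cong (+ (a + b) ℤ*_) (ℤ.pos-* (suc p) (suc p)) ⟩
  + (a + b) ℤ* (+ suc p ℤ* + suc p)               ∎)
  where open ≡-Reasoning

frac-+ : ∀ a b p → frac a (suc p) +ℚ frac b (suc p) ≡ frac (a + b) (suc p)
frac-+ a b p = trans (sym (ℚ.fromℚᵘ-toℚᵘ _)) (ℚ.fromℚᵘ-cong (begin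
  toℚᵘ (frac a (suc p) +ℚ frac b (suc p))         ≈⟨ ℚ.toℚᵘ-homo-+ (frac a (suc p)) (frac b (suc p)) ⟩
  toℚᵘ (frac a (suc p)) +ᵘ toℚᵘ (frac b (suc p))
    ≈⟨ ℚᵘ.+-cong (ℚ.toℚᵘ-fromℚᵘ (mkℚᵘ (+ a) p)) (ℚ.toℚᵘ-fromℚᵘ (mkℚᵘ (+ b) p)) ⟩
  mkℚᵘ (+ a) p +ᵘ mkℚᵘ (+ b) p                    ≈⟨ +ᵘ-same-denominator a b p ⟩
  mkℚᵘ (+ (a + b)) p                              ∎))
  where open ℚᵘ.≃-Reasoning

sumℚ-frac : ∀ (f : A → ℕ) p xs → sumℚ (map (λ x → frac (f x) (suc p)) xs) ≡ frac (∑ xs f) (suc p)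
sumℚ-frac f p []       = frac-cross 0 0 0 p refl
sumℚ-frac f p (x ∷ xs) = trans (cong (frac (f x) (suc p) +ℚ_) (sumℚ-frac f p xs)) (frac-+ (f x) (∑ xs f) p)

-- Orbits of size k through necklaces of size k

module _ (n k′ : ℕ) where

  private
    k : ℕ
    k = suc k′
    Lk : List Word
    Lk = filter (λ π → orbitSize π ≟ k) (Sn n)
    M : List (List ℕ)
    M = filter (λ x → length x ≟ k) (map necklaceSeq (Sn n))

  numOrbits*k≡length : numOrbits n k * k ≡ length Lk
  numOrbits*k≡length = begin
    numOrbits n k * k                                ≡⟨ ∑-const k reps ⟨
    ∑[ r ← reps ] k                                  ≡⟨ ∑-cong reps (sym ∘ class-size) ⟩
    ∑[ r ← reps ] length (filter (sameOrbit? r) Lk)  ≡⟨ length≡∑-class-sizes Lk-perms ⟨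
    length Lk                                        ∎
    where
    open ≡-Reasoning
    open Classes sameOrbit? SameOrbit-isEquivalence
    reps = deduplicate sameOrbit? Lk
    Lk-perms : All (IsPermutation n) Lk
    Lk-perms = All.tabulate (∈-Sn⁻ ∘ proj₁ ∘ ∈-filter⁻ (λ π → orbitSize π ≟ k) {xs = Sn n})
    class-size : ∀ {r} → r ∈ reps → length (filter (sameOrbit? r) Lk) ≡ k
    class-size r∈
      with r∈Sn , size≡k ← ∈-filter⁻ (λ π → orbitSize π ≟ k) {xs = Sn n} (∈-deduplicate⁻ sameOrbit? Lk r∈) =
      orbit-class-size {n} (∈-Sn⁻ r∈Sn) size≡k

  length-orbits≡length-necklaces : length Lk ≡ length M
  length-orbits≡length-necklaces = begin
    length Lk                                          ≡⟨ length-filter≡∑𝟙 (λ π → orbitSize π ≟ k) (Sn n) ⟩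
    ∑[ π ← Sn n ] 𝟙 (orbitSize π ≟ k)                  ≡⟨ ∑-cong (Sn n) (λ {π} _ → same-test π) ⟩
    ∑[ π ← Sn n ] 𝟙 (length (necklaceSeq π) ≟ k)       ≡⟨ ∑-map necklaceSeq (λ x → 𝟙 (length x ≟ k)) (Sn n) ⟨
    ∑[ x ← necklaces ] 𝟙 (length x ≟ k)                ≡⟨ length-filter≡∑𝟙 (λ x → length x ≟ k) necklaces ⟨
    length M                                           ∎
    where
    open ≡-Reasoning
    necklaces = map necklaceSeq (Sn n)
    same-test : ∀ π → 𝟙 (orbitSize π ≟ k) ≡ 𝟙 (length (necklaceSeq π) ≟ k)
    same-test π = 𝟙-cong (orbitSize π ≟ k) (length (necklaceSeq π) ≟ k)
                         (mk⇔ (trans (length-necklaceSeq π)) (trans (sym (length-necklaceSeq π))))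

  ∈-validNecklaces⁻ : ∀ {N} → N ∈ validNecklaces n k →
                      ∃ λ σ → IsPermutation n σ × necklaceSeq σ ≡ N × length N ≡ k
  ∈-validNecklaces⁻ N∈
    with N∈seqs , length≡k ←
           ∈-filter⁻ (λ x → length x ≟ k) {xs = map necklaceSeq (Sn n)} (∈-deduplicate⁻ rotEq? M N∈)
    with σ , σ∈ , refl ← ∈-map⁻ necklaceSeq N∈seqs = σ , ∈-Sn⁻ σ∈ , refl , length≡k

  necklace-class-size : ∀ {N} → N ∈ validNecklaces n k → length (filter (rotEq? N) M) ≡ necklaceClassSize n N
  necklace-class-size {N} N∈ with σ , p , refl , length≡k ← ∈-validNecklaces⁻ N∈ = begin
    length (filter (rotEq? N) M)
      ≡⟨ length-filter≡∑𝟙 (rotEq? N) M ⟩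
    ∑[ y ← M ] 𝟙 (rotEq? N y)
      ≡⟨ ∑-filter (λ x → length x ≟ k) (𝟙 ∘ rotEq? N) (map necklaceSeq (Sn n)) ⟩
    ∑[ y ← map necklaceSeq (Sn n) ] (𝟙 (length y ≟ k) * 𝟙 (rotEq? N y))
      ≡⟨ ∑-map necklaceSeq (λ y → 𝟙 (length y ≟ k) * 𝟙 (rotEq? N y)) (Sn n) ⟩
    ∑[ π ← Sn n ] (𝟙 (length (necklaceSeq π) ≟ k) * 𝟙 (rotEq? N (necklaceSeq π)))
      ≡⟨ ∑-cong (Sn n) (λ {π} _ → rotations-have-length-k (necklaceSeq π)) ⟩
    ∑[ π ← Sn n ] 𝟙 (rotEq? N (necklaceSeq π))
      ≡⟨ rotation-class-size p ⟩
    necklaceClassSize n N ∎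
    where
    open ≡-Reasoning
    rotations-have-length-k : ∀ y → 𝟙 (length y ≟ k) * 𝟙 (rotEq? N y) ≡ 𝟙 (rotEq? N y)
    rotations-have-length-k y with rotEq? N y
    ... | no _  = *-zeroʳ (𝟙 (length y ≟ k))
    ... | yes r with j , refl ← Equivalence.to (RotEq⇔ (necklaceSeq-nonempty p)) r =
      cong (_* 1) (𝟙-yes (length y ≟ k) (trans (length-rotateLeft^ j N) length≡k))

  numOrbits*k≡∑ : numOrbits n k * k ≡ ∑[ N ← validNecklaces n k ] necklaceClassSize n N
  numOrbits*k≡∑ = begin
    numOrbits n k * k                                         ≡⟨ numOrbits*k≡length ⟩
    length Lk                                                 ≡⟨ length-orbits≡length-necklaces ⟩
    length M                                                  ≡⟨ length≡∑-class-sizes M-nonempty ⟩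
    ∑[ N ← validNecklaces n k ] length (filter (rotEq? N) M)  ≡⟨ ∑-cong (validNecklaces n k) necklace-class-size ⟩
    ∑[ N ← validNecklaces n k ] necklaceClassSize n N         ∎
    where
    open ≡-Reasoning
    open Classes rotEq? RotEq-isEquivalence
    M-nonempty : All (λ x → 1 ≤ length x) M
    M-nonempty = All.tabulate λ x∈ →
      subst (1 ≤_) (sym (proj₂ (∈-filter⁻ (λ x → length x ≟ k) {xs = map necklaceSeq (Sn n)} x∈))) (s≤s z≤n)

  term≡ : ∀ {N} → N ∈ validNecklaces n k → term n N ≡ frac (necklaceClassSize n N) k
  term≡ {N} N∈ with σ , p , refl , length≡k ← ∈-validNecklaces⁻ N∈ =
    rescale (period N) (leastShift N) ((n ∸ distinctVals N) !)
            (trans (sym length≡k) (RotationClass.length≡period*leastShift N (necklaceSeq-nonempty p)))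
    where
    rescale : ∀ P t a → k ≡ P * t → frac a P ≡ frac (t * a) k
    rescale (suc p) t a k≡ =
      frac-cross a p (t * a) k′ (trans (cong (a *_) (trans k≡ (*-comm (suc p) t))) (x*[y*z]≡y*x*z a t (suc p)))

theorem4p2 : (n k : ℕ) →
    (+ numOrbits n k) /ℚ 1 ≡ sumℚ (map (term n) (validNecklaces n k))
theorem4p2 n zero = trans (cong (λ πs → (+ length (deduplicate sameOrbit? πs)) /ℚ 1) no-orbits)
                          (cong (λ xs → sumℚ (map (term n) (deduplicate rotEq? xs))) (sym no-necklaces))
  where
  no-orbits : filter (λ π → orbitSize π ≟ 0) (Sn n) ≡ []
  no-orbits = filter-none (λ π → orbitSize π ≟ 0) {Sn n}
    (All.tabulate λ π∈ size≡0 → <-irrefl (sym size≡0) (orbitSize-positive (∈-Sn⁻ {n} π∈)))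
  no-necklaces : filter (λ x → length x ≟ 0) (map necklaceSeq (Sn n)) ≡ []
  no-necklaces = filter-none (λ x → length x ≟ 0) {map necklaceSeq (Sn n)}
    (All.tabulate λ x∈ length≡0 → case ∈-map⁻ necklaceSeq x∈ of λ where
      (π , π∈ , refl) → <-irrefl (sym length≡0) (necklaceSeq-nonempty (∈-Sn⁻ {n} π∈)))
theorem4p2 n (suc k′) = begin
  (+ numOrbits n k) /ℚ 1
    ≡⟨ frac-cross (numOrbits n k) 0 (numOrbits n k * k) k′ (sym (*-identityʳ _)) ⟩
  frac (numOrbits n k * k) k
    ≡⟨ cong (λ m → frac m k) (numOrbits*k≡∑ n k′) ⟩
  frac (∑[ N ← necklaces ] necklaceClassSize n N) k
    ≡⟨ sumℚ-frac (necklaceClassSize n) k′ necklaces ⟨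
  sumℚ (map (λ N → frac (necklaceClassSize n N) k) necklaces)
    ≡⟨ cong sumℚ (map-cong-local (All.tabulate (term≡ n k′))) ⟨
  sumℚ (map (term n) necklaces) ∎
  where
  open ≡-Reasoning
  k = suc k′
  necklaces = validNecklaces n k
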